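{- For a prime $p$ let $\mathbb Z_p$ be the $p$-adic integers and $f(X,Y)=\operatorname{Tr}(XYX^{ -1}Y^{ -1})$ for $X,Y\in\operatorname{SL}_2(\mathbb Z_p)$. Then: (a) for $p>3$, the image of $f$ is all of $\mathbb Z_p$; (b) for $p=3$, no $t\in\mathbb Z_3$ with $t\equiv1,4,5,8\pmod9$ lies in the image of $f$; (c) for $p=2$, no $t\in\mathbb Z_2$ with $t\equiv0,1,4,5,8,9,10,12,13\pmod{16}$ lies in the image of $f$. -}

module Defs where

open import Data.Nat as ℕ using (ℕ; suc)
open import Data.Integer as ℤ using (ℤ; +_; _+_; _-_; _*_; -_)
open import Data.Integer.Properties using (+-inverseʳ; *-zeroˡ)
open import Data.Integer.Divisibility.Signed
  using (_∣_; divides; ∣m∣n⇒∣m+n; ∣m⇒∣-m; ∣n⇒∣m*n; ∣m⇒∣m*n)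
open import Relation.Binary.PropositionalEquality using (_≡_; subst; sym; trans)
open import Data.Product using (Σ)
open import Data.Integer.Tactic.RingSolver using (solve-∀)

-- The p-adic integers ℤ_p, as the inverse limit of the rings ℤ/pⁿℤ:
-- an element is a sequence of integers (x n) with x (n+1) ≡ x n (mod pⁿ);
-- x n represents the image of the element in ℤ/pⁿℤ.

pow : ℕ → ℕ → ℤ
pow p n = + (p ℕ.^ n)

_≡_[mod_^_] : ℤ → ℤ → ℕ → ℕ → Set
a ≡ b [mod p ^ n ] = pow p n ∣ (a - b)

record ℤp (p : ℕ) : Set where
  constructor mkℤp
  field
    seq : ℕ → ℤ
    coh : ∀ n → seq (suc n) ≡ seq n [mod p ^ n ]
open ℤp public

private
  add-lem : ∀ a b c d → (a + b) - (c + d) ≡ (a - c) + (b - d)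
  add-lem = solve-∀

  neg-lem : ∀ a c → (- a) - (- c) ≡ - (a - c)
  neg-lem = solve-∀

  mul-lem : ∀ a b c d → (a * b) - (c * d) ≡ a * (b - d) + (a - c) * d
  mul-lem = solve-∀

  ∣0 : ∀ k a → k ∣ (a - a)
  ∣0 k a = divides (+ 0) (trans (+-inverseʳ a) (sym (*-zeroˡ k)))

module _ {p : ℕ} where

  infix 4 _≈_
  _≈_ : ℤp p → ℤp p → Set
  x ≈ y = ∀ n → seq x n ≡ seq y n [mod p ^ n ]

  ι : ℤ → ℤp p
  ι a = mkℤp (λ _ → a) (λ n → ∣0 (pow p n) a)

  infixl 6 _⊕_ _⊖_
  infixl 7 _⊗_

  _⊕_ : ℤp p → ℤp p → ℤp p
  x ⊕ y = mkℤp (λ n → seq x n + seq y n)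
    (λ n → subst (pow p n ∣_)
      (sym (add-lem (seq x (suc n)) (seq y (suc n)) (seq x n) (seq y n)))
      (∣m∣n⇒∣m+n (coh x n) (coh y n)))

  ⊝_ : ℤp p → ℤp p
  ⊝ x = mkℤp (λ n → - seq x n)
    (λ n → subst (pow p n ∣_) (sym (neg-lem (seq x (suc n)) (seq x n)))
      (∣m⇒∣-m (coh x n)))

  _⊖_ : ℤp p → ℤp p → ℤp p
  x ⊖ y = x ⊕ (⊝ y)

  _⊗_ : ℤp p → ℤp p → ℤp p
  x ⊗ y = mkℤp (λ n → seq x n * seq y n)
    (λ n → subst (pow p n ∣_)
      (sym (mul-lem (seq x (suc n)) (seq y (suc n)) (seq x n) (seq y n)))
      (∣m∣n⇒∣m+n (∣n⇒∣m*n (seq x (suc n)) (coh y n))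
                 (∣m⇒∣m*n (seq y n) (coh x n))))

  _≡ᵖ_[mod^_] : ℤp p → ℤ → ℕ → Set
  x ≡ᵖ r [mod^ k ] = seq x k ≡ r [mod p ^ k ]

record M₂ (p : ℕ) : Set where
  constructor mat
  field
    a b c d : ℤp p
open M₂ public

module _ {p : ℕ} where

  det : M₂ p → ℤp p
  det X = (a X ⊗ d X) ⊖ (b X ⊗ c X)

  tr : M₂ p → ℤp p
  tr X = a X ⊕ d X

  infixl 7 _·_
  _·_ : M₂ p → M₂ p → M₂ p
  X · Y = mat (a X ⊗ a Y ⊕ b X ⊗ c Y) (a X ⊗ b Y ⊕ b X ⊗ d Y)
              (c X ⊗ a Y ⊕ d X ⊗ c Y) (c X ⊗ b Y ⊕ d X ⊗ d Y)

  -- adjugate matrix; for X ∈ SL₂ this is the inverse X⁻¹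
  adj : M₂ p → M₂ p
  adj X = mat (d X) (⊝ b X) (⊝ c X) (a X)

record SL₂ (p : ℕ) : Set where
  constructor sl
  field
    mtx  : M₂ p
    det1 : det mtx ≈ ι (+ 1)
open SL₂ public

module _ {p : ℕ} where

  _⁻¹ : SL₂ p → M₂ p
  X ⁻¹ = adj (mtx X)

  f : SL₂ p → SL₂ p → ℤp p
  f X Y = tr (mtx X · mtx Y · (X ⁻¹) · (Y ⁻¹))

  InImage : ℤp p → Set
  InImage t = Σ (SL₂ p) (λ X → Σ (SL₂ p) (λ Y → f X Y ≈ t))

{-# OPTIONS --safe #-}
module Submission where

-- (a) For p > 3, 6 is a unit of ℤ_p. For X = diag (2, 1/2) and
-- Y = [[1, 1], [c, 1 + c]] one has tr [X, Y] = 2 − 9c/4, which is any given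
-- t for c = 4 (2 − t) / 9.
--
-- (b), (c) Write X = a I + X₀ and Y = e I + Y₀ with X₀, Y₀ of the shape
-- [[0, b], [c, u]]. By the Fricke identity, tr [X, Y] − 2 = − det (X₀ Y₀ − Y₀ X₀),
-- which depends only on X₀ and Y₀ and is invariant under simultaneous
-- conjugation. Modulo N = 9, resp. 16, conjugation by elementary unipotents
-- brings X₀ to one of a few representatives, and an exhaustive computation
-- over the representatives and all Y₀ shows that tr [X, Y] − 2 avoids the
-- residues excluded in the statement.

open import Defs
open import Data.Nat using (ℕ; _<_)
open import Data.Nat.Primality using (Prime)
open import Data.Integer using (+_)
open import Data.Product using (_×_)
open import Data.Sum using (_⊎_)
open import Relation.Nullary using (¬_)

open import Data.Bool using (Bool; true; false; T; not; if_then_else_)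
open import Data.Bool.ListAction using (all; any)
open import Data.Empty using (⊥-elim)
open import Data.Integer as ℤ using (ℤ; _+_; _-_; _*_; -_)
open import Data.Integer.Divisibility.Signed
  using (_∣_; divides; _∣?_; ∣-refl; ∣-trans; ∣m∣n⇒∣m+n; ∣m⇒∣-m; ∣n⇒∣m*n; ∣m⇒∣m*n;
         *-monoˡ-∣; *-monoʳ-∣; ∣⇒∣ᵤ)
open import Data.Integer.DivMod using (_%_; _/_; a≡a%n+[a/n]*n; n%d<d)
import Data.Integer.Properties as ℤ
open import Data.Integer.Tactic.RingSolver using (solve-∀)
open import Data.List using (List; []; _∷_; upTo)
open import Data.List.Membership.Propositional using (_∈_; lose)
open import Data.List.Membership.Propositional.Properties using (∈-upTo⁺)
import Data.List.Relation.Unary.All as All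
open import Data.List.Relation.Unary.All.Properties using (all⁺)
open import Data.List.Relation.Unary.Any.Properties using (any⁺)
open import Data.Maybe using (Maybe; just; nothing)
open import Data.Nat as ℕ using (zero; suc)
open import Data.Nat.Divisibility using (hasNonTrivialDivisor)
open import Data.Nat.Primality using (prime⇒rough)
import Data.Nat.Properties as ℕ
open import Data.Product using (Σ; ∃; ∃₂; _,_; proj₁; proj₂)
open import Data.Product.Properties using (≡-dec)
open import Data.Sum using ([_,_]′)
open import Data.Unit using (tt)
open import Relation.Binary using (Setoid)
open import Relation.Binary.PropositionalEquality
  using (_≡_; refl; sym; trans; cong; subst; subst₂; module ≡-Reasoning)
open import Relation.Nullary using (Dec)
open import Relation.Nullary.Decidable using (map′; isYes; toWitness; fromWitness)

open import Data.List.Membership.DecPropositional (≡-dec ℤ._≟_ (≡-dec ℤ._≟_ ℤ._≟_))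
  using () renaming (_∈?_ to _∈ᵀ?_)
open import Data.List.Membership.DecPropositional ℕ._≟_
  using () renaming (_∈?_ to _∈ℕ?_)

T-if : ∀ {b x} → T (if b then x else true) → T b → T x
T-if {true} ok _ = ok

T-not⇒¬T : ∀ {b} → T (not b) → ¬ T b
T-not⇒¬T {false} _ ()

-- Congruences of integers

module Congruence (m : ℤ) where

  -- A record rather than the bare divisibility, so that x and y can be
  -- inferred from a proof.
  infix 4 _≋_
  record _≋_ (x y : ℤ) : Set where
    constructor ≋⁺
    field ≋⁻ : m ∣ x - y
  open _≋_ public

  private
    x-x≡0 : ∀ x → x - x ≡ + 0
    x-x≡0 = solve-∀
    neg-swap : ∀ x y → - (x - y) ≡ y - x
    neg-swap = solve-∀
    split-trans : ∀ x y z → (x - y) + (y - z) ≡ x - z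
    split-trans = solve-∀
    split-+ : ∀ x x′ y y′ → (x + y) - (x′ + y′) ≡ (x - x′) + (y - y′)
    split-+ = solve-∀
    split-neg : ∀ x x′ → (- x) - (- x′) ≡ - (x - x′)
    split-neg = solve-∀
    split-* : ∀ x x′ y y′ → x * y - x′ * y′ ≡ x * (y - y′) + (x - x′) * y′
    split-* = solve-∀

  ≋-reflexive : ∀ {x y} → x ≡ y → x ≋ y
  ≋-reflexive {x} refl = ≋⁺ (divides (+ 0) (trans (x-x≡0 x) (sym (ℤ.*-zeroˡ m))))

  ≋-refl : ∀ {x} → x ≋ x
  ≋-refl = ≋-reflexive refl

  ≋-sym : ∀ {x y} → x ≋ y → y ≋ x
  ≋-sym {x} {y} (≋⁺ m∣x-y) = ≋⁺ (subst (m ∣_) (neg-swap x y) (∣m⇒∣-m m∣x-y))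

  ≋-trans : ∀ {x y z} → x ≋ y → y ≋ z → x ≋ z
  ≋-trans {x} {y} {z} (≋⁺ m∣x-y) (≋⁺ m∣y-z) =
    ≋⁺ (subst (m ∣_) (split-trans x y z) (∣m∣n⇒∣m+n m∣x-y m∣y-z))

  +-cong : ∀ {x x′ y y′} → x ≋ x′ → y ≋ y′ → x + y ≋ x′ + y′
  +-cong {x} {x′} {y} {y′} (≋⁺ m∣x) (≋⁺ m∣y) =
    ≋⁺ (subst (m ∣_) (sym (split-+ x x′ y y′)) (∣m∣n⇒∣m+n m∣x m∣y))

  neg-cong : ∀ {x x′} → x ≋ x′ → - x ≋ - x′
  neg-cong {x} {x′} (≋⁺ m∣x) = ≋⁺ (subst (m ∣_) (sym (split-neg x x′)) (∣m⇒∣-m m∣x))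

  −-cong : ∀ {x x′ y y′} → x ≋ x′ → y ≋ y′ → x - y ≋ x′ - y′
  −-cong x≋x′ y≋y′ = +-cong x≋x′ (neg-cong y≋y′)

  *-cong : ∀ {x x′ y y′} → x ≋ x′ → y ≋ y′ → x * y ≋ x′ * y′
  *-cong {x} {x′} {y} {y′} (≋⁺ m∣x) (≋⁺ m∣y) =
    ≋⁺ (subst (m ∣_) (sym (split-* x x′ y y′)) (∣m∣n⇒∣m+n (∣n⇒∣m*n x m∣y) (∣m⇒∣m*n y′ m∣x)))

  infix 4 _≋?_
  _≋?_ : ∀ x y → Dec (x ≋ y)
  x ≋? y = map′ ≋⁺ ≋⁻ (m ∣? (x - y))

  ≋-setoid : Setoid _ _
  ≋-setoid = record
    { Carrier = ℤ ; _≈_ = _≋_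
    ; isEquivalence = record { refl = ≋-refl ; sym = ≋-sym ; trans = ≋-trans } }

-- Matrices modulo scalars and the commutator trace

-- (b , c , u) stands for the matrices [[a, b], [c, a + u]], a arbitrary;
-- detDefect a A is det − 1 of the one with top-left entry a.
Triple : Set
Triple = ℤ × ℤ × ℤ

detDefect : ℤ → Triple → ℤ
detDefect a (b , c , u) = a * (a + u) - + 1 - b * c

-- κ A B = − det (A B − B A), which does not depend on the chosen members.
κ : Triple → Triple → ℤ
κ (b , c , u) (f , g , w) = (b * g - c * f) * (b * g - c * f) + (f * u - b * w) * (c * w - g * u)

-- tr (X Y adj X adj Y) for X = [[a, b], [c, d]] and Y = [[e, f], [g, h]],
-- written so that seq (f X Y) n reduces to it.
commutatorTrace : (a b c d e f g h : ℤ) → ℤ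
commutatorTrace a b c d e f g h =
  ((((a * e + b * g) * d + (a * f + b * h) * (- c)) * h
     + ((a * e + b * g) * (- b) + (a * f + b * h) * a) * (- g))
  + (((c * e + d * g) * d + (c * f + d * h) * (- c)) * (- f)
     + ((c * e + d * g) * (- b) + (c * f + d * h) * a) * e))

-- Conjugation by [[1, 1], [0, 1]] and by [[1, 0], [1, 1]]; conjScalar is
-- the new top-left entry.
data Elementary : Set where
  upper lower : Elementary

conj : Elementary → Triple → Triple
conj upper (b , c , u) = (b + u - c , c , u - (c + c))
conj lower (b , c , u) = (b , c - b - u , u + (b + b))

conjScalar : Elementary → ℤ → Triple → ℤ
conjScalar upper a (b , c , u) = a + c
conjScalar lower a (b , c , u) = a - b

-- The ring solver does not unfold definitions, so these identities spell
-- out κ, detDefect and commutatorTrace.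
private
  κ-upper : ∀ b c u f g w →
    ((b + u - c) * g - c * (f + w - g)) * ((b + u - c) * g - c * (f + w - g))
      + ((f + w - g) * (u - (c + c)) - (b + u - c) * (w - (g + g)))
        * (c * (w - (g + g)) - g * (u - (c + c)))
    ≡ (b * g - c * f) * (b * g - c * f) + (f * u - b * w) * (c * w - g * u)
  κ-upper = solve-∀

  κ-lower : ∀ b c u f g w →
    (b * (g - f - w) - (c - b - u) * f) * (b * (g - f - w) - (c - b - u) * f)
      + (f * (u + (b + b)) - b * (w + (f + f)))
        * ((c - b - u) * (w + (f + f)) - (g - f - w) * (u + (b + b)))
    ≡ (b * g - c * f) * (b * g - c * f) + (f * u - b * w) * (c * w - g * u)
  κ-lower = solve-∀

  detDefect-upper : ∀ a b c u →
    (a + c) * ((a + c) + (u - (c + c))) - + 1 - (b + u - c) * c ≡ a * (a + u) - + 1 - b * c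
  detDefect-upper = solve-∀

  detDefect-lower : ∀ a b c u →
    (a - b) * ((a - b) + (u + (b + b))) - + 1 - b * (c - b - u) ≡ a * (a + u) - + 1 - b * c
  detDefect-lower = solve-∀

  commutatorTrace-expanded : ∀ a b c d e f g h →
    ((((a * e + b * g) * d + (a * f + b * h) * (- c)) * h
       + ((a * e + b * g) * (- b) + (a * f + b * h) * a) * (- g))
    + (((c * e + d * g) * d + (c * f + d * h) * (- c)) * (- f)
       + ((c * e + d * g) * (- b) + (c * f + d * h) * a) * e))
    ≡ + 2 * (a * d - b * c) * (e * h - f * g)
      + ((b * g - c * f) * (b * g - c * f)
         + (f * (d - a) - b * (h - e)) * (c * (h - e) - g * (d - a)))
  commutatorTrace-expanded = solve-∀

  detDefect-expanded : ∀ a b c d → a * (a + (d - a)) - + 1 - b * c ≡ (a * d - b * c) - + 1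
  detDefect-expanded = solve-∀

κ-conj : ∀ e A B → κ (conj e A) (conj e B) ≡ κ A B
κ-conj upper (b , c , u) (f , g , w) = κ-upper b c u f g w
κ-conj lower (b , c , u) (f , g , w) = κ-lower b c u f g w

detDefect-conj : ∀ e a A → detDefect (conjScalar e a A) (conj e A) ≡ detDefect a A
detDefect-conj upper a (b , c , u) = detDefect-upper a b c u
detDefect-conj lower a (b , c , u) = detDefect-lower a b c u

commutatorTrace-κ : ∀ a b c d e f g h →
  commutatorTrace a b c d e f g h
    ≡ + 2 * (a * d - b * c) * (e * h - f * g) + κ (b , c , d - a) (f , g , h - e)
commutatorTrace-κ = commutatorTrace-expanded

detDefect-entries : ∀ a b c d → detDefect a (b , c , d - a) ≡ (a * d - b * c) - + 1
detDefect-entries = detDefect-expanded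

-- Residues of the commutator trace modulo pᵏ, by a finite certificate

-- strategy names, for a triple of residues, the elementary conjugation to
-- apply next (nothing: stop); fuel bounds the length of the walk. The
-- walk need not be correct: reachesRepresentative checks where it ends.
-- allowed is the claimed set of residues of κ, checked by κ-table.
module ResidueCertificate
  (p k : ℕ) {{_ : ℕ.NonZero (p ℕ.^ k)}}
  (strategy : ℤ → ℤ → ℤ → Maybe Elementary)
  (representatives : List Triple)
  (fuel : ℕ)
  (allowed : List ℕ)
  where

  N : ℤ
  N = pow p k

  open Congruence N
  open import Relation.Binary.Reasoning.Setoid ≋-setoid

  private
    x-[x+qn]≡-qn : ∀ x q n → x - (x + q * n) ≡ - q * n
    x-[x+qn]≡-qn = solve-∀
    [2+x]-2≡x : ∀ x → x ≡ (+ 2 + x) - + 2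
    [2+x]-2≡x = solve-∀

  reduce : ℤ → ℤ
  reduce x = + (x % N)

  reduce-≋ : ∀ x → reduce x ≋ x
  reduce-≋ x = ≋⁺ (divides (- (x / N))
    (trans (cong (λ y → reduce x - y) (a≡a%n+[a/n]*n x N)) (x-[x+qn]≡-qn (reduce x) (x / N) N)))

  residues : List ℕ
  residues = upTo (p ℕ.^ k)

  %-∈-residues : ∀ x → x % N ∈ residues
  %-∈-residues x = ∈-upTo⁺ (n%d<d x N)

  infix 4 _≋ᵀ_
  data _≋ᵀ_ : Triple → Triple → Set where
    ≋ᵀ⁺ : ∀ {b c u b′ c′ u′} → b ≋ b′ → c ≋ c′ → u ≋ u′ → (b , c , u) ≋ᵀ (b′ , c′ , u′)

  ≋ᵀ-refl : ∀ {A} → A ≋ᵀ A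
  ≋ᵀ-refl {b , c , u} = ≋ᵀ⁺ ≋-refl ≋-refl ≋-refl

  detDefect-cong : ∀ {a a′ A A′} → a ≋ a′ → A ≋ᵀ A′ → detDefect a A ≋ detDefect a′ A′
  detDefect-cong a≋ (≋ᵀ⁺ b≋ c≋ u≋) =
    −-cong (−-cong (*-cong a≋ (+-cong a≋ u≋)) ≋-refl) (*-cong b≋ c≋)

  κ-cong : ∀ {A A′ B B′} → A ≋ᵀ A′ → B ≋ᵀ B′ → κ A B ≋ κ A′ B′
  κ-cong (≋ᵀ⁺ b≋ c≋ u≋) (≋ᵀ⁺ f≋ g≋ w≋) =
    +-cong (*-cong bg-cf bg-cf)
           (*-cong (−-cong (*-cong f≋ u≋) (*-cong b≋ w≋)) (−-cong (*-cong c≋ w≋) (*-cong g≋ u≋)))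
    where bg-cf = −-cong (*-cong b≋ g≋) (*-cong c≋ f≋)

  reduceT : Triple → Triple
  reduceT (b , c , u) = (reduce b , reduce c , reduce u)

  reduceT-≋ᵀ : ∀ A → reduceT A ≋ᵀ A
  reduceT-≋ᵀ (b , c , u) = ≋ᵀ⁺ (reduce-≋ b) (reduce-≋ c) (reduce-≋ u)

  MeetsSL₂ : Triple → Set
  MeetsSL₂ A = ∃ λ a → detDefect a A ≋ + 0

  detOneAt : Triple → ℕ → Bool
  detOneAt A i = isYes (detDefect (+ i) A ≋? + 0)

  meetsSL₂? : Triple → Bool
  meetsSL₂? A = any (detOneAt A) residues

  MeetsSL₂-resp : ∀ {A A′} → A ≋ᵀ A′ → MeetsSL₂ A′ → MeetsSL₂ A
  MeetsSL₂-resp A≋A′ (a , defect≋0) = a , ≋-trans (detDefect-cong (≋-refl {a}) A≋A′) defect≋0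

  meetsSL₂?-complete : ∀ A → MeetsSL₂ A → T (meetsSL₂? A)
  meetsSL₂?-complete A (a , defect≋0) = any⁺ (detOneAt A) (lose (%-∈-residues a)
    (fromWitness (≋-trans (detDefect-cong (reduce-≋ a) (≋ᵀ-refl {A})) defect≋0)))

  step : Elementary → Triple → Triple
  step e A = reduceT (conj e A)

  route : ℕ → Triple → List Elementary
  route zero    A = []
  route (suc n) A@(b , c , u) with strategy b c u
  ... | nothing = []
  ... | just e  = e ∷ route n (step e A)

  run : List Elementary → Triple → Triple
  run []       A = A
  run (e ∷ es) A = run es (step e A)

  run-reduceT : ∀ es A → ∃ λ A′ → run es (reduceT A) ≡ reduceT A′
  run-reduceT []       A = A , refl
  run-reduceT (e ∷ es) A = run-reduceT es (conj e (reduceT A))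

  MeetsSL₂-run : ∀ es {A} → MeetsSL₂ A → MeetsSL₂ (run es A)
  MeetsSL₂-run []       A-meets = A-meets
  MeetsSL₂-run (e ∷ es) {A} (a , defect≋0) = MeetsSL₂-run es (reduce (conjScalar e a A) ,
    ≋-trans (detDefect-cong (reduce-≋ (conjScalar e a A)) (reduceT-≋ᵀ (conj e A)))
            (≋-trans (≋-reflexive (detDefect-conj e a A)) defect≋0))

  κ-run : ∀ es A B → κ (run es A) (run es B) ≋ κ A B
  κ-run []       A B = ≋-refl
  κ-run (e ∷ es) A B = ≋-trans (κ-run es (step e A) (step e B))
    (≋-trans (κ-cong (reduceT-≋ᵀ (conj e A)) (reduceT-≋ᵀ (conj e B))) (≋-reflexive (κ-conj e A B)))

  allReduced : (Triple → Bool) → Bool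
  allReduced P = all (λ i → all (λ j → all (λ l → P (+ i , + j , + l)) residues) residues) residues

  allReduced-sound : ∀ P → T (allReduced P) → ∀ A → T (P (reduceT A))
  allReduced-sound P ok (b , c , u) = at u (at c (at b ok))
    where
    at : ∀ {Q} x → T (all Q residues) → T (Q (x % N))
    at {Q} x ok = All.lookup (all⁺ Q residues ok) (%-∈-residues x)

  walksToRepresentative : Triple → Bool
  walksToRepresentative A = isYes (run (route fuel A) A ∈ᵀ? representatives)

  κ-residueAllowed : Triple → Triple → Bool
  κ-residueAllowed B R = isYes (κ R B % N ∈ℕ? allowed)

  κ-tableRow : Triple → Bool
  κ-tableRow B = all (κ-residueAllowed B) representatives

  whenMeetsSL₂ : (Triple → Bool) → Triple → Bool
  whenMeetsSL₂ P A = if meetsSL₂? A then P A else true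

  reachesRepresentative : Bool
  reachesRepresentative = allReduced (whenMeetsSL₂ walksToRepresentative)

  κ-table : Bool
  κ-table = allReduced (whenMeetsSL₂ κ-tableRow)

  excludes : ℤ → Bool
  excludes x = all (λ r → not (isYes (+ r ≋? x))) allowed

  excludes-sound : ∀ {x r} → T (excludes x) → r ∈ allowed → ¬ (+ r ≋ x)
  excludes-sound {x} ex r∈ r≋x =
    T-not⇒¬T (All.lookup (all⁺ _ allowed ex) r∈) (fromWitness r≋x)

  -- Conjugate A to a representative R, with the same conjugations applied
  -- to B; κ is unchanged and the table covers κ R B′.
  κ-allowed : T reachesRepresentative → T κ-table →
    ∀ {A B} → MeetsSL₂ A → MeetsSL₂ B → ∃ λ r → r ∈ allowed × + r ≋ κ A B
  κ-allowed reaches table {A} {B} A-meets B-meets = κ R B₁ % N , r∈allowed , r≋κ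
    where
    A₀ = reduceT A
    es = route fuel A₀
    R  = run es A₀
    B′ = proj₁ (run-reduceT es B)
    B₁ = reduceT B′
    run-B : run es (reduceT B) ≡ B₁
    run-B = proj₂ (run-reduceT es B)
    R∈representatives : R ∈ representatives
    R∈representatives = toWitness
      (T-if (allReduced-sound (whenMeetsSL₂ walksToRepresentative) reaches A)
            (meetsSL₂?-complete A₀ (MeetsSL₂-resp (reduceT-≋ᵀ A) A-meets)))
    B₁-meetsSL₂ : MeetsSL₂ B₁
    B₁-meetsSL₂ = subst MeetsSL₂ run-B (MeetsSL₂-run es (MeetsSL₂-resp (reduceT-≋ᵀ B) B-meets))
    row : T (κ-tableRow B₁)
    row = T-if (allReduced-sound (whenMeetsSL₂ κ-tableRow) table B′)
               (meetsSL₂?-complete B₁ B₁-meetsSL₂)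
    r∈allowed : κ R B₁ % N ∈ allowed
    r∈allowed = toWitness
      (All.lookup (all⁺ (κ-residueAllowed B₁) representatives row) R∈representatives)
    r≋κ : + (κ R B₁ % N) ≋ κ A B
    r≋κ = begin
      + (κ R B₁ % N)       ≈⟨ reduce-≋ (κ R B₁) ⟩
      κ R B₁               ≡⟨ cong (κ R) run-B ⟨
      κ R (run es (reduceT B)) ≈⟨ κ-run es A₀ (reduceT B) ⟩
      κ A₀ (reduceT B)     ≈⟨ κ-cong (reduceT-≋ᵀ A) (reduceT-≋ᵀ B) ⟩
      κ A B                ∎

  MeetsSL₂-entries : ∀ a b c d → a * d - b * c ≋ + 1 → MeetsSL₂ (b , c , d - a)
  MeetsSL₂-entries a b c d det≋1 =
    a , ≋-trans (≋-reflexive (detDefect-entries a b c d)) (−-cong det≋1 ≋-refl)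

  κ≋commutatorTrace-2 : ∀ a b c d e f g h → a * d - b * c ≋ + 1 → e * h - f * g ≋ + 1 →
    κ (b , c , d - a) (f , g , h - e) ≋ commutatorTrace a b c d e f g h - + 2
  κ≋commutatorTrace-2 a b c d e f g h detX≋1 detY≋1 = begin
    κ A B                                   ≡⟨ [2+x]-2≡x (κ A B) ⟩
    + 2 + κ A B - + 2                       ≈⟨ −-cong (+-cong 2detXdetY≋2 ≋-refl) ≋-refl ⟨
    + 2 * (a * d - b * c) * (e * h - f * g) + κ A B - + 2
      ≡⟨ cong (_- + 2) (commutatorTrace-κ a b c d e f g h) ⟨
    commutatorTrace a b c d e f g h - + 2   ∎
    where
    A = (b , c , d - a)
    B = (f , g , h - e)
    2detXdetY≋2 : + 2 * (a * d - b * c) * (e * h - f * g) ≋ + 2 * + 1 * + 1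
    2detXdetY≋2 = *-cong (*-cong (≋-refl {+ 2}) detX≋1) detY≋1

  noPreimage : T reachesRepresentative → T κ-table →
    ∀ t₀ → T (excludes (t₀ - + 2)) → (t : ℤp p) → t ≡ᵖ t₀ [mod^ k ] → ¬ InImage t
  noPreimage reaches table t₀ ex t t≡t₀ (X , Y , fXY≈t) =
    let (r , r∈ , r≋κ) = κ-allowed reaches table {A} {B}
          (MeetsSL₂-entries x₁₁ x₁₂ x₂₁ x₂₂ detX≋1) (MeetsSL₂-entries y₁₁ y₁₂ y₂₁ y₂₂ detY≋1)
    in excludes-sound ex r∈ (begin
      + r                                     ≈⟨ r≋κ ⟩
      κ A B
        ≈⟨ κ≋commutatorTrace-2 x₁₁ x₁₂ x₂₁ x₂₂ y₁₁ y₁₂ y₂₁ y₂₂ detX≋1 detY≋1 ⟩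
      seq (f X Y) k - + 2                     ≈⟨ −-cong fXY≋t₀ ≋-refl ⟩
      t₀ - + 2                                ∎)
    where
    x₁₁ = seq (a (mtx X)) k
    x₁₂ = seq (b (mtx X)) k
    x₂₁ = seq (c (mtx X)) k
    x₂₂ = seq (d (mtx X)) k
    y₁₁ = seq (a (mtx Y)) k
    y₁₂ = seq (b (mtx Y)) k
    y₂₁ = seq (c (mtx Y)) k
    y₂₂ = seq (d (mtx Y)) k
    A = (x₁₂ , x₂₁ , x₂₂ - x₁₁)
    B = (y₁₂ , y₂₁ , y₂₂ - y₁₁)
    fXY≋t₀ : seq (f X Y) k ≋ t₀
    fXY≋t₀ = ≋-trans (≋⁺ (fXY≈t k)) (≋⁺ t≡t₀)
    detX≋1 = ≋⁺ (det1 X k)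
    detY≋1 = ≋⁺ (det1 Y k)

-- Surjectivity for p > 3

prime>3⇒6-invertible : ∀ {p} → Prime p → 3 < p → ∃₂ λ v k → + 6 * v ≡ + 1 + + p * k
prime>3⇒6-invertible {p} pr 3<p =
  byResidue (+ p % + 6) {+ p / + 6} (n%d<d (+ p) (+ 6)) (a≡a%n+[a/n]*n (+ p) (+ 6))
  where
  6[-q]≡1-[1+6q] : ∀ q → + 6 * (- q) ≡ + 1 + (+ 1 + q * + 6) * - + 1
  6[-q]≡1-[1+6q] = solve-∀
  6[q+1]≡1+[5+6q] : ∀ q → + 6 * (q + + 1) ≡ + 1 + (+ 5 + q * + 6) * + 1
  6[q+1]≡1+[5+6q] = solve-∀

  2<p : 2 < p
  2<p = ℕ.<-trans (ℕ.n<1+n 2) 3<p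

  notDivisor : ∀ d .{{_ : ℕ.NonTrivial d}} → d < p → ¬ + d ∣ + p
  notDivisor d d<p d∣p = prime⇒rough pr (hasNonTrivialDivisor d<p (∣⇒∣ᵤ d∣p))

  commonDivisor : ∀ {d} r q → + d ∣ + r → + d ∣ + 6 → + p ≡ + r + q * + 6 → + d ∣ + p
  commonDivisor r q d∣r d∣6 p≡r+6q =
    subst (_ ∣_) (sym p≡r+6q) (∣m∣n⇒∣m+n d∣r (∣n⇒∣m*n q d∣6))

  byResidue : ∀ r {q} → r < 6 → + p ≡ + r + q * + 6 → ∃₂ λ v k → + 6 * v ≡ + 1 + + p * k
  byResidue 0 {q} _ eq = ⊥-elim (notDivisor 2 2<p
    (commonDivisor 0 q (divides (+ 0) refl) (divides (+ 3) refl) eq))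
  byResidue 1 {q} _ eq =
    - q , - + 1 , trans (6[-q]≡1-[1+6q] q) (cong (λ x → + 1 + x * - + 1) (sym eq))
  byResidue 2 {q} _ eq = ⊥-elim (notDivisor 2 2<p
    (commonDivisor 2 q (divides (+ 1) refl) (divides (+ 3) refl) eq))
  byResidue 3 {q} _ eq = ⊥-elim (notDivisor 3 3<p
    (commonDivisor 3 q (divides (+ 1) refl) (divides (+ 2) refl) eq))
  byResidue 4 {q} _ eq = ⊥-elim (notDivisor 2 2<p
    (commonDivisor 4 q (divides (+ 2) refl) (divides (+ 3) refl) eq))
  byResidue 5 {q} _ eq =
    q + + 1 , + 1 , trans (6[q+1]≡1+[5+6q] q) (cong (λ x → + 1 + x * + 1) (sym eq))
  byResidue (suc (suc (suc (suc (suc (suc _))))))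
    (ℕ.s≤s (ℕ.s≤s (ℕ.s≤s (ℕ.s≤s (ℕ.s≤s (ℕ.s≤s ())))))) _

module _ {p : ℕ} where

  pow∣-recurrence : ∀ {w} → + p ∣ w → (E : ℕ → ℤ) → (∀ n → E (suc n) ≡ w * E n) →
                    ∀ n → pow p n ∣ E n
  pow∣-recurrence p∣w E rec zero = divides (E 0) (sym (ℤ.*-identityʳ (E 0)))
  pow∣-recurrence {w} p∣w E rec (suc n) = subst₂ _∣_ (sym (ℤ.pos-* p (p ℕ.^ n))) (sym (rec n))
    (∣-trans (*-monoˡ-∣ (pow p n) p∣w) (*-monoʳ-∣ w (pow∣-recurrence p∣w E rec n)))

  -- With w = 1 − a v ∈ p ℤ, the partial sums v (1 + w + ⋯ + wⁿ⁻¹) invert a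
  -- modulo pⁿ.
  invertible⇒unit : ∀ {a v k} → a * v ≡ + 1 + + p * k → Σ (ℤp p) λ x → ι a ⊗ x ≈ ι (+ 1)
  invertible⇒unit {a} {v} {k} av≡1+pk = mkℤp (λ n → v * partialSum n) coherent , inverse
    where
    w : ℤ
    w = + p * (- k)

    partialSum : ℕ → ℤ
    partialSum zero    = + 0
    partialSum (suc n) = + 1 + w * partialSum n

    p∣w : + p ∣ w
    p∣w = ∣m⇒∣m*n (- k) ∣-refl

    difference-step : ∀ r x y → (+ 1 + r * x) - (+ 1 + r * y) ≡ r * (x - y)
    difference-step = solve-∀
    factor : ∀ v x y → v * x - v * y ≡ v * (x - y)
    factor = solve-∀
    regroup : ∀ a v P k S → a * (v * (+ 1 + P * (- k) * S)) - + 1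
                          ≡ P * (- k) * (a * (v * S) - + 1) + (a * v - (+ 1 + P * k))
    regroup = solve-∀
    x+[y-y]≡x : ∀ x y → x + (y - y) ≡ x
    x+[y-y]≡x = solve-∀

    coherent : ∀ n → pow p n ∣ v * partialSum (suc n) - v * partialSum n
    coherent n = subst (pow p n ∣_) (sym (factor v (partialSum (suc n)) (partialSum n)))
      (∣n⇒∣m*n v (pow∣-recurrence p∣w (λ m → partialSum (suc m) - partialSum m)
        (λ m → difference-step w (partialSum (suc m)) (partialSum m)) n))

    inverse-step : ∀ S → a * (v * (+ 1 + w * S)) - + 1 ≡ w * (a * (v * S) - + 1)
    inverse-step S = begin
      a * (v * (+ 1 + w * S)) - + 1  ≡⟨ regroup a v (+ p) k S ⟩
      wE + (a * v - m)               ≡⟨ cong (λ x → wE + (x - m)) av≡1+pk ⟩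
      wE + (m - m)                   ≡⟨ x+[y-y]≡x wE m ⟩
      wE                             ∎
      where
      open ≡-Reasoning
      wE = w * (a * (v * S) - + 1)
      m  = + 1 + + p * k

    inverse : ι a ⊗ mkℤp (λ n → v * partialSum n) coherent ≈ ι (+ 1)
    inverse = pow∣-recurrence p∣w (λ n → a * (v * partialSum n) - + 1)
                                  (λ n → inverse-step (partialSum n))

six-unit : ∀ {p} → Prime p → 3 < p → Σ (ℤp p) λ u → ι (+ 6) ⊗ u ≈ ι (+ 1)
six-unit pr 3<p with v , k , 6v≡1+pk ← prime>3⇒6-invertible pr 3<p =
  invertible⇒unit {a = + 6} {v} {k} 6v≡1+pk

private
  diagonal-expanded : ∀ l m c →
    + 2 * (l * m - + 0 * + 0) * (+ 1 * (+ 1 + c) - + 1 * c)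
      + ((+ 0 * c - + 0 * + 1) * (+ 0 * c - + 0 * + 1)
         + (+ 1 * (m - l) - + 0 * ((+ 1 + c) - + 1)) * (+ 0 * ((+ 1 + c) - + 1) - c * (m - l)))
    ≡ + 2 * l * m - c * ((l - m) * (l - m))
  diagonal-expanded = solve-∀

commutatorTrace-diagonal : ∀ l m c →
  commutatorTrace l (+ 0) (+ 0) m (+ 1) (+ 1) c (+ 1 + c) ≡ + 2 * l * m - c * ((l - m) * (l - m))
commutatorTrace-diagonal l m c =
  trans (commutatorTrace-κ l (+ 0) (+ 0) m (+ 1) (+ 1) c (+ 1 + c)) (diagonal-expanded l m c)

-- Since 1 − 4u (2 − 3u) = (6u − 1) (2u − 1), the witness below has trace
-- t modulo 6u − 1.
witness-trace : ∀ u t →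
  + 2 * + 2 * (+ 3 * u) - + 16 * u * u * (+ 2 - t) * ((+ 2 - + 3 * u) * (+ 2 - + 3 * u)) - t
    ≡ (+ 6 * u - + 1) * (+ 2 - (+ 2 - t) * (+ 12 * u * u - + 8 * u - + 1) * (+ 2 * u - + 1))
witness-trace = solve-∀

commutatorTrace-surjective : ∀ p → Prime p → 3 < p → (t : ℤp p) → InImage t
commutatorTrace-surjective p pr 3<p t = X , Y , fXY≈t
  where
  u : ℤp p
  u = proj₁ (six-unit pr 3<p)
  6u≈1 : ι (+ 6) ⊗ u ≈ ι (+ 1)
  6u≈1 = proj₂ (six-unit pr 3<p)

  detX-expanded : ∀ x → + 2 * (+ 3 * x) - + 0 * + 0 - + 1 ≡ + 6 * x - + 1
  detX-expanded = solve-∀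
  detY-expanded : ∀ y → + 1 * (+ 1 + y) - + 1 * y - + 1 ≡ + 0
  detY-expanded = solve-∀

  γ : ℤp p
  γ = ι (+ 16) ⊗ u ⊗ u ⊗ (ι (+ 2) ⊖ t)

  X Y : SL₂ p
  X = sl (mat (ι (+ 2)) (ι (+ 0)) (ι (+ 0)) (ι (+ 3) ⊗ u))
         (λ n → subst (pow p n ∣_) (sym (detX-expanded (seq u n))) (6u≈1 n))
  Y = sl (mat (ι (+ 1)) (ι (+ 1)) γ (ι (+ 1) ⊕ γ))
         (λ n → divides (+ 0) (trans (detY-expanded (seq γ n)) (sym (ℤ.*-zeroˡ (pow p n)))))

  fXY≈t : f X Y ≈ t
  fXY≈t n = subst (pow p n ∣_)
    (sym (trans (cong (_- seq t n) (commutatorTrace-diagonal (+ 2) (+ 3 * seq u n) (seq γ n)))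
                (witness-trace (seq u n) (seq t n))))
    (∣m⇒∣m*n _ (6u≈1 n))

-- The certificates modulo 9 and modulo 16

-- The strategies were found by a computer search.
strategy9 : ℤ → ℤ → ℤ → Maybe Elementary
strategy9 (+ 0) (+ 0) (+ 6) = just lower
strategy9 (+ 0) (+ 1) (+ 3) = just lower
strategy9 (+ 0) (+ 1) (+ 6) = just upper
strategy9 (+ 0) (+ 2) (+ 3) = just upper
strategy9 (+ 0) (+ 2) (+ 6) = just lower
strategy9 (+ 0) (+ 3) (+ 3) = just lower
strategy9 (+ 0) (+ 3) (+ 6) = just upper
strategy9 (+ 0) (+ 4) (+ 0) = just upper
strategy9 (+ 0) (+ 4) (+ 3) = just upper
strategy9 (+ 0) (+ 4) (+ 6) = just lower
strategy9 (+ 0) (+ 5) (+ 0) = just upper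
strategy9 (+ 0) (+ 5) (+ 3) = just lower
strategy9 (+ 0) (+ 5) (+ 6) = just lower
strategy9 (+ 0) (+ 6) (+ 3) = just lower
strategy9 (+ 0) (+ 6) (+ 6) = just upper
strategy9 (+ 0) (+ 7) (+ 0) = just upper
strategy9 (+ 0) (+ 7) (+ 3) = just lower
strategy9 (+ 0) (+ 7) (+ 6) = just lower
strategy9 (+ 0) (+ 8) (+ 0) = just upper
strategy9 (+ 0) (+ 8) (+ 3) = just lower
strategy9 (+ 0) (+ 8) (+ 6) = just upper
strategy9 (+ 1) (+ 0) (+ 0) = just lower
strategy9 (+ 1) (+ 0) (+ 3) = just upper
strategy9 (+ 1) (+ 0) (+ 6) = just lower
strategy9 (+ 1) (+ 1) (+ 8) = just lower
strategy9 (+ 1) (+ 2) (+ 1) = just upper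
strategy9 (+ 1) (+ 2) (+ 5) = just lower
strategy9 (+ 1) (+ 2) (+ 7) = just lower
strategy9 (+ 1) (+ 2) (+ 8) = just upper
strategy9 (+ 1) (+ 3) (+ 0) = just lower
strategy9 (+ 1) (+ 3) (+ 3) = just lower
strategy9 (+ 1) (+ 3) (+ 6) = just upper
strategy9 (+ 1) (+ 4) (+ 4) = just lower
strategy9 (+ 1) (+ 4) (+ 5) = just upper
strategy9 (+ 1) (+ 5) (+ 1) = just lower
strategy9 (+ 1) (+ 5) (+ 2) = just lower
strategy9 (+ 1) (+ 5) (+ 4) = just lower
strategy9 (+ 1) (+ 5) (+ 5) = just upper
strategy9 (+ 1) (+ 5) (+ 7) = just lower
strategy9 (+ 1) (+ 5) (+ 8) = just lower
strategy9 (+ 1) (+ 6) (+ 0) = just lower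
strategy9 (+ 1) (+ 6) (+ 3) = just lower
strategy9 (+ 1) (+ 6) (+ 6) = just upper
strategy9 (+ 1) (+ 7) (+ 2) = just lower
strategy9 (+ 1) (+ 7) (+ 7) = just upper
strategy9 (+ 1) (+ 8) (+ 0) = just upper
strategy9 (+ 1) (+ 8) (+ 1) = just lower
strategy9 (+ 1) (+ 8) (+ 2) = just upper
strategy9 (+ 1) (+ 8) (+ 3) = just upper
strategy9 (+ 1) (+ 8) (+ 4) = just upper
strategy9 (+ 1) (+ 8) (+ 5) = just lower
strategy9 (+ 1) (+ 8) (+ 6) = just lower
strategy9 (+ 1) (+ 8) (+ 7) = just lower
strategy9 (+ 1) (+ 8) (+ 8) = just upper
strategy9 (+ 2) (+ 0) (+ 0) = just lower
strategy9 (+ 2) (+ 0) (+ 3) = just upper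
strategy9 (+ 2) (+ 0) (+ 6) = just upper
strategy9 (+ 2) (+ 1) (+ 1) = just upper
strategy9 (+ 2) (+ 1) (+ 5) = just lower
strategy9 (+ 2) (+ 1) (+ 7) = just lower
strategy9 (+ 2) (+ 1) (+ 8) = just upper
strategy9 (+ 2) (+ 2) (+ 4) = just lower
strategy9 (+ 2) (+ 2) (+ 5) = just upper
strategy9 (+ 2) (+ 3) (+ 0) = just lower
strategy9 (+ 2) (+ 3) (+ 3) = just upper
strategy9 (+ 2) (+ 3) (+ 6) = just lower
strategy9 (+ 2) (+ 4) (+ 0) = just upper
strategy9 (+ 2) (+ 4) (+ 1) = just lower
strategy9 (+ 2) (+ 4) (+ 2) = just upper
strategy9 (+ 2) (+ 4) (+ 3) = just upper
strategy9 (+ 2) (+ 4) (+ 4) = just lower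
strategy9 (+ 2) (+ 4) (+ 5) = just lower
strategy9 (+ 2) (+ 4) (+ 6) = just upper
strategy9 (+ 2) (+ 4) (+ 7) = just lower
strategy9 (+ 2) (+ 4) (+ 8) = just upper
strategy9 (+ 2) (+ 5) (+ 1) = just lower
strategy9 (+ 2) (+ 5) (+ 8) = just upper
strategy9 (+ 2) (+ 6) (+ 0) = just lower
strategy9 (+ 2) (+ 6) (+ 3) = just lower
strategy9 (+ 2) (+ 6) (+ 6) = just upper
strategy9 (+ 2) (+ 7) (+ 1) = just upper
strategy9 (+ 2) (+ 7) (+ 2) = just lower
strategy9 (+ 2) (+ 7) (+ 4) = just upper
strategy9 (+ 2) (+ 7) (+ 5) = just upper
strategy9 (+ 2) (+ 7) (+ 7) = just upper
strategy9 (+ 2) (+ 7) (+ 8) = just lower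
strategy9 (+ 2) (+ 8) (+ 2) = just upper
strategy9 (+ 2) (+ 8) (+ 7) = just lower
strategy9 (+ 3) (+ 0) (+ 0) = just lower
strategy9 (+ 3) (+ 0) (+ 3) = just upper
strategy9 (+ 3) (+ 0) (+ 6) = just lower
strategy9 (+ 3) (+ 1) (+ 0) = just upper
strategy9 (+ 3) (+ 1) (+ 3) = just lower
strategy9 (+ 3) (+ 1) (+ 6) = just upper
strategy9 (+ 3) (+ 2) (+ 0) = just upper
strategy9 (+ 3) (+ 2) (+ 3) = just upper
strategy9 (+ 3) (+ 2) (+ 6) = just lower
strategy9 (+ 3) (+ 3) (+ 0) = just upper
strategy9 (+ 3) (+ 3) (+ 6) = just lower
strategy9 (+ 3) (+ 4) (+ 0) = just lower
strategy9 (+ 3) (+ 4) (+ 3) = just upper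
strategy9 (+ 3) (+ 4) (+ 6) = just upper
strategy9 (+ 3) (+ 5) (+ 0) = just lower
strategy9 (+ 3) (+ 5) (+ 3) = just upper
strategy9 (+ 3) (+ 5) (+ 6) = just lower
strategy9 (+ 3) (+ 6) (+ 0) = just lower
strategy9 (+ 3) (+ 6) (+ 3) = just upper
strategy9 (+ 3) (+ 6) (+ 6) = just upper
strategy9 (+ 3) (+ 7) (+ 0) = just upper
strategy9 (+ 3) (+ 7) (+ 3) = just lower
strategy9 (+ 3) (+ 7) (+ 6) = just lower
strategy9 (+ 3) (+ 8) (+ 0) = just lower
strategy9 (+ 3) (+ 8) (+ 3) = just lower
strategy9 (+ 3) (+ 8) (+ 6) = just lower
strategy9 (+ 4) (+ 0) (+ 0) = just lower
strategy9 (+ 4) (+ 0) (+ 3) = just upper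
strategy9 (+ 4) (+ 0) (+ 6) = just upper
strategy9 (+ 4) (+ 1) (+ 4) = just upper
strategy9 (+ 4) (+ 1) (+ 5) = just upper
strategy9 (+ 4) (+ 2) (+ 0) = just upper
strategy9 (+ 4) (+ 2) (+ 1) = just lower
strategy9 (+ 4) (+ 2) (+ 2) = just upper
strategy9 (+ 4) (+ 2) (+ 3) = just lower
strategy9 (+ 4) (+ 2) (+ 4) = just upper
strategy9 (+ 4) (+ 2) (+ 5) = just upper
strategy9 (+ 4) (+ 2) (+ 6) = just lower
strategy9 (+ 4) (+ 2) (+ 7) = just upper
strategy9 (+ 4) (+ 2) (+ 8) = just upper
strategy9 (+ 4) (+ 3) (+ 0) = just upper
strategy9 (+ 4) (+ 3) (+ 3) = just upper
strategy9 (+ 4) (+ 3) (+ 6) = just lower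
strategy9 (+ 4) (+ 4) (+ 2) = just upper
strategy9 (+ 4) (+ 4) (+ 7) = just lower
strategy9 (+ 4) (+ 5) (+ 1) = just lower
strategy9 (+ 4) (+ 5) (+ 2) = just lower
strategy9 (+ 4) (+ 5) (+ 4) = just upper
strategy9 (+ 4) (+ 5) (+ 5) = just upper
strategy9 (+ 4) (+ 5) (+ 7) = just upper
strategy9 (+ 4) (+ 5) (+ 8) = just upper
strategy9 (+ 4) (+ 6) (+ 0) = just lower
strategy9 (+ 4) (+ 6) (+ 3) = just upper
strategy9 (+ 4) (+ 6) (+ 6) = just upper
strategy9 (+ 4) (+ 7) (+ 1) = just upper
strategy9 (+ 4) (+ 7) (+ 8) = just lower
strategy9 (+ 4) (+ 8) (+ 1) = just upper
strategy9 (+ 4) (+ 8) (+ 2) = just lower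
strategy9 (+ 4) (+ 8) (+ 4) = just upper
strategy9 (+ 4) (+ 8) (+ 5) = just lower
strategy9 (+ 4) (+ 8) (+ 7) = just lower
strategy9 (+ 4) (+ 8) (+ 8) = just upper
strategy9 (+ 5) (+ 0) (+ 0) = just lower
strategy9 (+ 5) (+ 0) (+ 3) = just lower
strategy9 (+ 5) (+ 0) (+ 6) = just upper
strategy9 (+ 5) (+ 1) (+ 1) = just upper
strategy9 (+ 5) (+ 1) (+ 2) = just upper
strategy9 (+ 5) (+ 1) (+ 4) = just upper
strategy9 (+ 5) (+ 1) (+ 5) = just lower
strategy9 (+ 5) (+ 1) (+ 7) = just upper
strategy9 (+ 5) (+ 1) (+ 8) = just upper
strategy9 (+ 5) (+ 2) (+ 1) = just upper
strategy9 (+ 5) (+ 2) (+ 8) = just lower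
strategy9 (+ 5) (+ 3) (+ 0) = just upper
strategy9 (+ 5) (+ 3) (+ 3) = just upper
strategy9 (+ 5) (+ 3) (+ 6) = just lower
strategy9 (+ 5) (+ 4) (+ 1) = just upper
strategy9 (+ 5) (+ 4) (+ 2) = just lower
strategy9 (+ 5) (+ 4) (+ 4) = just upper
strategy9 (+ 5) (+ 4) (+ 5) = just lower
strategy9 (+ 5) (+ 4) (+ 7) = just upper
strategy9 (+ 5) (+ 4) (+ 8) = just lower
strategy9 (+ 5) (+ 5) (+ 2) = just lower
strategy9 (+ 5) (+ 5) (+ 7) = just upper
strategy9 (+ 5) (+ 6) (+ 0) = just upper
strategy9 (+ 5) (+ 6) (+ 3) = just lower
strategy9 (+ 5) (+ 6) (+ 6) = just lower
strategy9 (+ 5) (+ 7) (+ 0) = just lower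
strategy9 (+ 5) (+ 7) (+ 1) = just upper
strategy9 (+ 5) (+ 7) (+ 2) = just lower
strategy9 (+ 5) (+ 7) (+ 3) = just lower
strategy9 (+ 5) (+ 7) (+ 4) = just upper
strategy9 (+ 5) (+ 7) (+ 5) = just upper
strategy9 (+ 5) (+ 7) (+ 6) = just lower
strategy9 (+ 5) (+ 7) (+ 7) = just upper
strategy9 (+ 5) (+ 7) (+ 8) = just lower
strategy9 (+ 5) (+ 8) (+ 4) = just upper
strategy9 (+ 5) (+ 8) (+ 5) = just lower
strategy9 (+ 6) (+ 0) (+ 0) = just lower
strategy9 (+ 6) (+ 0) (+ 3) = just upper
strategy9 (+ 6) (+ 0) (+ 6) = just lower
strategy9 (+ 6) (+ 1) (+ 0) = just upper
strategy9 (+ 6) (+ 1) (+ 3) = just lower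
strategy9 (+ 6) (+ 1) (+ 6) = just upper
strategy9 (+ 6) (+ 2) (+ 0) = just upper
strategy9 (+ 6) (+ 2) (+ 3) = just lower
strategy9 (+ 6) (+ 2) (+ 6) = just upper
strategy9 (+ 6) (+ 3) (+ 0) = just upper
strategy9 (+ 6) (+ 3) (+ 3) = just upper
strategy9 (+ 6) (+ 3) (+ 6) = just upper
strategy9 (+ 6) (+ 4) (+ 0) = just upper
strategy9 (+ 6) (+ 4) (+ 3) = just lower
strategy9 (+ 6) (+ 4) (+ 6) = just lower
strategy9 (+ 6) (+ 5) (+ 0) = just lower
strategy9 (+ 6) (+ 5) (+ 3) = just lower
strategy9 (+ 6) (+ 5) (+ 6) = just upper
strategy9 (+ 6) (+ 6) (+ 0) = just lower
strategy9 (+ 6) (+ 6) (+ 3) = just upper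
strategy9 (+ 6) (+ 6) (+ 6) = just lower
strategy9 (+ 6) (+ 7) (+ 0) = just lower
strategy9 (+ 6) (+ 7) (+ 3) = just lower
strategy9 (+ 6) (+ 7) (+ 6) = just lower
strategy9 (+ 6) (+ 8) (+ 0) = just lower
strategy9 (+ 6) (+ 8) (+ 3) = just upper
strategy9 (+ 6) (+ 8) (+ 6) = just lower
strategy9 (+ 7) (+ 0) (+ 0) = just lower
strategy9 (+ 7) (+ 0) (+ 3) = just lower
strategy9 (+ 7) (+ 0) (+ 6) = just upper
strategy9 (+ 7) (+ 1) (+ 2) = just lower
strategy9 (+ 7) (+ 1) (+ 7) = just upper
strategy9 (+ 7) (+ 2) (+ 1) = just upper
strategy9 (+ 7) (+ 2) (+ 2) = just upper
strategy9 (+ 7) (+ 2) (+ 4) = just upper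
strategy9 (+ 7) (+ 2) (+ 5) = just upper
strategy9 (+ 7) (+ 2) (+ 7) = just upper
strategy9 (+ 7) (+ 2) (+ 8) = just lower
strategy9 (+ 7) (+ 3) (+ 0) = just lower
strategy9 (+ 7) (+ 3) (+ 3) = just upper
strategy9 (+ 7) (+ 3) (+ 6) = just upper
strategy9 (+ 7) (+ 4) (+ 1) = just lower
strategy9 (+ 7) (+ 4) (+ 8) = just upper
strategy9 (+ 7) (+ 5) (+ 0) = just upper
strategy9 (+ 7) (+ 5) (+ 1) = just lower
strategy9 (+ 7) (+ 5) (+ 2) = just lower
strategy9 (+ 7) (+ 5) (+ 3) = just upper
strategy9 (+ 7) (+ 5) (+ 4) = just lower
strategy9 (+ 7) (+ 5) (+ 5) = just lower
strategy9 (+ 7) (+ 5) (+ 6) = just upper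
strategy9 (+ 7) (+ 5) (+ 7) = just lower
strategy9 (+ 7) (+ 5) (+ 8) = just upper
strategy9 (+ 7) (+ 6) (+ 0) = just upper
strategy9 (+ 7) (+ 6) (+ 3) = just upper
strategy9 (+ 7) (+ 6) (+ 6) = just upper
strategy9 (+ 7) (+ 7) (+ 4) = just upper
strategy9 (+ 7) (+ 7) (+ 5) = just lower
strategy9 (+ 7) (+ 8) (+ 1) = just upper
strategy9 (+ 7) (+ 8) (+ 2) = just lower
strategy9 (+ 7) (+ 8) (+ 4) = just lower
strategy9 (+ 7) (+ 8) (+ 5) = just upper
strategy9 (+ 7) (+ 8) (+ 7) = just lower
strategy9 (+ 7) (+ 8) (+ 8) = just lower
strategy9 (+ 8) (+ 0) (+ 0) = just lower
strategy9 (+ 8) (+ 0) (+ 3) = just upper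
strategy9 (+ 8) (+ 0) (+ 6) = just lower
strategy9 (+ 8) (+ 1) (+ 0) = just lower
strategy9 (+ 8) (+ 1) (+ 1) = just upper
strategy9 (+ 8) (+ 1) (+ 2) = just upper
strategy9 (+ 8) (+ 1) (+ 3) = just upper
strategy9 (+ 8) (+ 1) (+ 4) = just upper
strategy9 (+ 8) (+ 1) (+ 5) = just lower
strategy9 (+ 8) (+ 1) (+ 6) = just lower
strategy9 (+ 8) (+ 1) (+ 7) = just upper
strategy9 (+ 8) (+ 1) (+ 8) = just upper
strategy9 (+ 8) (+ 2) (+ 2) = just upper
strategy9 (+ 8) (+ 2) (+ 7) = just lower
strategy9 (+ 8) (+ 3) (+ 0) = just upper
strategy9 (+ 8) (+ 3) (+ 3) = just upper
strategy9 (+ 8) (+ 3) (+ 6) = just upper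
strategy9 (+ 8) (+ 4) (+ 1) = just lower
strategy9 (+ 8) (+ 4) (+ 2) = just upper
strategy9 (+ 8) (+ 4) (+ 4) = just lower
strategy9 (+ 8) (+ 4) (+ 5) = just upper
strategy9 (+ 8) (+ 4) (+ 7) = just lower
strategy9 (+ 8) (+ 4) (+ 8) = just lower
strategy9 (+ 8) (+ 5) (+ 4) = just lower
strategy9 (+ 8) (+ 5) (+ 5) = just lower
strategy9 (+ 8) (+ 6) (+ 0) = just upper
strategy9 (+ 8) (+ 6) (+ 3) = just upper
strategy9 (+ 8) (+ 6) (+ 6) = just lower
strategy9 (+ 8) (+ 7) (+ 1) = just lower
strategy9 (+ 8) (+ 7) (+ 2) = just upper
strategy9 (+ 8) (+ 7) (+ 4) = just lower
strategy9 (+ 8) (+ 7) (+ 5) = just lower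
strategy9 (+ 8) (+ 7) (+ 7) = just upper
strategy9 (+ 8) (+ 7) (+ 8) = just lower
strategy9 (+ 8) (+ 8) (+ 1) = just upper
strategy9 (+ 8) (+ 8) (+ 8) = just lower
strategy9 _ _ _ = nothing

representatives9 : List Triple
representatives9 = (+ 0 , + 0 , + 0) ∷ (+ 0 , + 0 , + 3) ∷ (+ 0 , + 1 , + 0) ∷ (+ 0 , + 2 , + 0) ∷ (+ 0 , + 3 , + 0) ∷ (+ 0 , + 6 , + 0) ∷ (+ 1 , + 1 , + 1) ∷ (+ 1 , + 2 , + 2) ∷ (+ 1 , + 2 , + 4) ∷ (+ 2 , + 1 , + 2) ∷ (+ 2 , + 1 , + 4) ∷ (+ 3 , + 3 , + 3) ∷ []

κ-residues9 : List ℕ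
κ-residues9 = 0 ∷ 1 ∷ 4 ∷ 5 ∷ 7 ∷ []

module Modulo9 = ResidueCertificate 3 2 strategy9 representatives9 9 κ-residues9

strategy16 : ℤ → ℤ → ℤ → Maybe Elementary
strategy16 (+ 0) (+ 1) (+ 8) = just upper
strategy16 (+ 0) (+ 3) (+ 8) = just upper
strategy16 (+ 0) (+ 5) (+ 8) = just upper
strategy16 (+ 0) (+ 7) (+ 8) = just upper
strategy16 (+ 0) (+ 8) (+ 8) = just lower
strategy16 (+ 0) (+ 9) (+ 0) = just upper
strategy16 (+ 0) (+ 9) (+ 8) = just upper
strategy16 (+ 0) (+ 10) (+ 8) = just lower
strategy16 (+ 0) (+ 11) (+ 0) = just upper
strategy16 (+ 0) (+ 11) (+ 8) = just upper
strategy16 (+ 0) (+ 12) (+ 8) = just lower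
strategy16 (+ 0) (+ 13) (+ 0) = just upper
strategy16 (+ 0) (+ 13) (+ 8) = just upper
strategy16 (+ 0) (+ 14) (+ 8) = just lower
strategy16 (+ 0) (+ 15) (+ 0) = just upper
strategy16 (+ 0) (+ 15) (+ 8) = just upper
strategy16 (+ 1) (+ 0) (+ 0) = just lower
strategy16 (+ 1) (+ 0) (+ 8) = just lower
strategy16 (+ 1) (+ 1) (+ 9) = just upper
strategy16 (+ 1) (+ 1) (+ 11) = just lower
strategy16 (+ 1) (+ 1) (+ 13) = just lower
strategy16 (+ 1) (+ 1) (+ 15) = just lower
strategy16 (+ 1) (+ 2) (+ 14) = just lower
strategy16 (+ 1) (+ 3) (+ 0) = just lower
strategy16 (+ 1) (+ 3) (+ 1) = just lower
strategy16 (+ 1) (+ 3) (+ 3) = just lower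
strategy16 (+ 1) (+ 3) (+ 5) = just lower
strategy16 (+ 1) (+ 3) (+ 7) = just upper
strategy16 (+ 1) (+ 3) (+ 8) = just lower
strategy16 (+ 1) (+ 3) (+ 9) = just lower
strategy16 (+ 1) (+ 3) (+ 11) = just upper
strategy16 (+ 1) (+ 3) (+ 13) = just upper
strategy16 (+ 1) (+ 3) (+ 15) = just lower
strategy16 (+ 1) (+ 4) (+ 12) = just upper
strategy16 (+ 1) (+ 5) (+ 1) = just lower
strategy16 (+ 1) (+ 5) (+ 3) = just lower
strategy16 (+ 1) (+ 5) (+ 5) = just lower
strategy16 (+ 1) (+ 5) (+ 7) = just upper
strategy16 (+ 1) (+ 5) (+ 9) = just lower
strategy16 (+ 1) (+ 5) (+ 11) = just upper
strategy16 (+ 1) (+ 5) (+ 13) = just lower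
strategy16 (+ 1) (+ 5) (+ 15) = just lower
strategy16 (+ 1) (+ 6) (+ 10) = just upper
strategy16 (+ 1) (+ 7) (+ 1) = just lower
strategy16 (+ 1) (+ 7) (+ 2) = just lower
strategy16 (+ 1) (+ 7) (+ 3) = just lower
strategy16 (+ 1) (+ 7) (+ 5) = just lower
strategy16 (+ 1) (+ 7) (+ 6) = just upper
strategy16 (+ 1) (+ 7) (+ 7) = just upper
strategy16 (+ 1) (+ 7) (+ 9) = just lower
strategy16 (+ 1) (+ 7) (+ 10) = just upper
strategy16 (+ 1) (+ 7) (+ 11) = just lower
strategy16 (+ 1) (+ 7) (+ 13) = just upper
strategy16 (+ 1) (+ 7) (+ 14) = just upper
strategy16 (+ 1) (+ 7) (+ 15) = just lower
strategy16 (+ 1) (+ 8) (+ 0) = just lower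
strategy16 (+ 1) (+ 8) (+ 8) = just lower
strategy16 (+ 1) (+ 9) (+ 1) = just lower
strategy16 (+ 1) (+ 9) (+ 3) = just upper
strategy16 (+ 1) (+ 9) (+ 5) = just lower
strategy16 (+ 1) (+ 9) (+ 7) = just lower
strategy16 (+ 1) (+ 9) (+ 9) = just upper
strategy16 (+ 1) (+ 9) (+ 11) = just upper
strategy16 (+ 1) (+ 9) (+ 13) = just lower
strategy16 (+ 1) (+ 9) (+ 15) = just lower
strategy16 (+ 1) (+ 10) (+ 6) = just upper
strategy16 (+ 1) (+ 10) (+ 10) = just lower
strategy16 (+ 1) (+ 11) (+ 1) = just lower
strategy16 (+ 1) (+ 11) (+ 3) = just lower
strategy16 (+ 1) (+ 11) (+ 4) = just lower
strategy16 (+ 1) (+ 11) (+ 5) = just upper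
strategy16 (+ 1) (+ 11) (+ 7) = just upper
strategy16 (+ 1) (+ 11) (+ 9) = just lower
strategy16 (+ 1) (+ 11) (+ 11) = just lower
strategy16 (+ 1) (+ 11) (+ 12) = just lower
strategy16 (+ 1) (+ 11) (+ 13) = just upper
strategy16 (+ 1) (+ 11) (+ 15) = just upper
strategy16 (+ 1) (+ 12) (+ 4) = just upper
strategy16 (+ 1) (+ 12) (+ 12) = just upper
strategy16 (+ 1) (+ 13) (+ 1) = just lower
strategy16 (+ 1) (+ 13) (+ 3) = just upper
strategy16 (+ 1) (+ 13) (+ 5) = just upper
strategy16 (+ 1) (+ 13) (+ 7) = just lower
strategy16 (+ 1) (+ 13) (+ 9) = just upper
strategy16 (+ 1) (+ 13) (+ 11) = just lower
strategy16 (+ 1) (+ 13) (+ 13) = just upper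
strategy16 (+ 1) (+ 13) (+ 15) = just lower
strategy16 (+ 1) (+ 14) (+ 2) = just lower
strategy16 (+ 1) (+ 14) (+ 14) = just upper
strategy16 (+ 1) (+ 15) (+ 0) = just lower
strategy16 (+ 1) (+ 15) (+ 1) = just lower
strategy16 (+ 1) (+ 15) (+ 2) = just upper
strategy16 (+ 1) (+ 15) (+ 3) = just lower
strategy16 (+ 1) (+ 15) (+ 4) = just lower
strategy16 (+ 1) (+ 15) (+ 5) = just lower
strategy16 (+ 1) (+ 15) (+ 6) = just upper
strategy16 (+ 1) (+ 15) (+ 7) = just lower
strategy16 (+ 1) (+ 15) (+ 8) = just lower
strategy16 (+ 1) (+ 15) (+ 9) = just upper
strategy16 (+ 1) (+ 15) (+ 10) = just lower
strategy16 (+ 1) (+ 15) (+ 11) = just lower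
strategy16 (+ 1) (+ 15) (+ 12) = just lower
strategy16 (+ 1) (+ 15) (+ 13) = just lower
strategy16 (+ 1) (+ 15) (+ 14) = just lower
strategy16 (+ 1) (+ 15) (+ 15) = just upper
strategy16 (+ 2) (+ 0) (+ 0) = just lower
strategy16 (+ 2) (+ 0) (+ 8) = just lower
strategy16 (+ 2) (+ 1) (+ 14) = just lower
strategy16 (+ 2) (+ 2) (+ 12) = just lower
strategy16 (+ 2) (+ 3) (+ 6) = just lower
strategy16 (+ 2) (+ 3) (+ 10) = just upper
strategy16 (+ 2) (+ 4) (+ 0) = just lower
strategy16 (+ 2) (+ 5) (+ 6) = just lower
strategy16 (+ 2) (+ 5) (+ 10) = just upper
strategy16 (+ 2) (+ 6) (+ 4) = just upper
strategy16 (+ 2) (+ 6) (+ 12) = just lower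
strategy16 (+ 2) (+ 7) (+ 2) = just lower
strategy16 (+ 2) (+ 7) (+ 14) = just lower
strategy16 (+ 2) (+ 8) (+ 0) = just lower
strategy16 (+ 2) (+ 8) (+ 8) = just lower
strategy16 (+ 2) (+ 9) (+ 2) = just lower
strategy16 (+ 2) (+ 9) (+ 14) = just lower
strategy16 (+ 2) (+ 10) (+ 4) = just lower
strategy16 (+ 2) (+ 10) (+ 12) = just lower
strategy16 (+ 2) (+ 11) (+ 6) = just upper
strategy16 (+ 2) (+ 11) (+ 10) = just upper
strategy16 (+ 2) (+ 12) (+ 0) = just lower
strategy16 (+ 2) (+ 12) (+ 8) = just lower
strategy16 (+ 2) (+ 13) (+ 6) = just upper
strategy16 (+ 2) (+ 13) (+ 10) = just lower
strategy16 (+ 2) (+ 14) (+ 4) = just upper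
strategy16 (+ 2) (+ 14) (+ 12) = just upper
strategy16 (+ 2) (+ 15) (+ 2) = just lower
strategy16 (+ 2) (+ 15) (+ 14) = just upper
strategy16 (+ 3) (+ 0) (+ 0) = just lower
strategy16 (+ 3) (+ 0) (+ 8) = just lower
strategy16 (+ 3) (+ 1) (+ 0) = just upper
strategy16 (+ 3) (+ 1) (+ 1) = just upper
strategy16 (+ 3) (+ 1) (+ 3) = just lower
strategy16 (+ 3) (+ 1) (+ 5) = just lower
strategy16 (+ 3) (+ 1) (+ 7) = just lower
strategy16 (+ 3) (+ 1) (+ 8) = just upper
strategy16 (+ 3) (+ 1) (+ 9) = just upper
strategy16 (+ 3) (+ 1) (+ 11) = just upper
strategy16 (+ 3) (+ 1) (+ 13) = just upper
strategy16 (+ 3) (+ 1) (+ 15) = just upper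
strategy16 (+ 3) (+ 2) (+ 10) = just lower
strategy16 (+ 3) (+ 3) (+ 1) = just lower
strategy16 (+ 3) (+ 3) (+ 3) = just upper
strategy16 (+ 3) (+ 3) (+ 5) = just lower
strategy16 (+ 3) (+ 3) (+ 7) = just upper
strategy16 (+ 3) (+ 3) (+ 9) = just lower
strategy16 (+ 3) (+ 3) (+ 11) = just upper
strategy16 (+ 3) (+ 3) (+ 13) = just upper
strategy16 (+ 3) (+ 3) (+ 15) = just upper
strategy16 (+ 3) (+ 4) (+ 4) = just upper
strategy16 (+ 3) (+ 4) (+ 12) = just upper
strategy16 (+ 3) (+ 5) (+ 0) = just lower
strategy16 (+ 3) (+ 5) (+ 1) = just lower
strategy16 (+ 3) (+ 5) (+ 2) = just upper
strategy16 (+ 3) (+ 5) (+ 3) = just upper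
strategy16 (+ 3) (+ 5) (+ 4) = just lower
strategy16 (+ 3) (+ 5) (+ 5) = just lower
strategy16 (+ 3) (+ 5) (+ 7) = just upper
strategy16 (+ 3) (+ 5) (+ 8) = just lower
strategy16 (+ 3) (+ 5) (+ 9) = just lower
strategy16 (+ 3) (+ 5) (+ 10) = just upper
strategy16 (+ 3) (+ 5) (+ 11) = just upper
strategy16 (+ 3) (+ 5) (+ 12) = just lower
strategy16 (+ 3) (+ 5) (+ 13) = just lower
strategy16 (+ 3) (+ 5) (+ 14) = just upper
strategy16 (+ 3) (+ 5) (+ 15) = just upper
strategy16 (+ 3) (+ 6) (+ 2) = just upper
strategy16 (+ 3) (+ 6) (+ 14) = just lower
strategy16 (+ 3) (+ 7) (+ 1) = just upper
strategy16 (+ 3) (+ 7) (+ 3) = just lower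
strategy16 (+ 3) (+ 7) (+ 5) = just upper
strategy16 (+ 3) (+ 7) (+ 7) = just upper
strategy16 (+ 3) (+ 7) (+ 9) = just lower
strategy16 (+ 3) (+ 7) (+ 11) = just upper
strategy16 (+ 3) (+ 7) (+ 13) = just lower
strategy16 (+ 3) (+ 7) (+ 15) = just upper
strategy16 (+ 3) (+ 8) (+ 0) = just lower
strategy16 (+ 3) (+ 8) (+ 8) = just lower
strategy16 (+ 3) (+ 9) (+ 1) = just lower
strategy16 (+ 3) (+ 9) (+ 3) = just upper
strategy16 (+ 3) (+ 9) (+ 4) = just lower
strategy16 (+ 3) (+ 9) (+ 5) = just lower
strategy16 (+ 3) (+ 9) (+ 7) = just upper
strategy16 (+ 3) (+ 9) (+ 9) = just lower
strategy16 (+ 3) (+ 9) (+ 11) = just upper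
strategy16 (+ 3) (+ 9) (+ 12) = just lower
strategy16 (+ 3) (+ 9) (+ 13) = just lower
strategy16 (+ 3) (+ 9) (+ 15) = just upper
strategy16 (+ 3) (+ 10) (+ 2) = just upper
strategy16 (+ 3) (+ 10) (+ 14) = just lower
strategy16 (+ 3) (+ 11) (+ 1) = just lower
strategy16 (+ 3) (+ 11) (+ 3) = just upper
strategy16 (+ 3) (+ 11) (+ 5) = just lower
strategy16 (+ 3) (+ 11) (+ 7) = just lower
strategy16 (+ 3) (+ 11) (+ 9) = just upper
strategy16 (+ 3) (+ 11) (+ 11) = just upper
strategy16 (+ 3) (+ 11) (+ 13) = just lower
strategy16 (+ 3) (+ 11) (+ 15) = just upper
strategy16 (+ 3) (+ 12) (+ 4) = just lower
strategy16 (+ 3) (+ 12) (+ 12) = just upper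
strategy16 (+ 3) (+ 13) (+ 1) = just upper
strategy16 (+ 3) (+ 13) (+ 2) = just upper
strategy16 (+ 3) (+ 13) (+ 3) = just lower
strategy16 (+ 3) (+ 13) (+ 5) = just upper
strategy16 (+ 3) (+ 13) (+ 6) = just lower
strategy16 (+ 3) (+ 13) (+ 7) = just upper
strategy16 (+ 3) (+ 13) (+ 9) = just lower
strategy16 (+ 3) (+ 13) (+ 10) = just upper
strategy16 (+ 3) (+ 13) (+ 11) = just upper
strategy16 (+ 3) (+ 13) (+ 13) = just upper
strategy16 (+ 3) (+ 13) (+ 14) = just lower
strategy16 (+ 3) (+ 13) (+ 15) = just upper
strategy16 (+ 3) (+ 14) (+ 6) = just lower
strategy16 (+ 3) (+ 14) (+ 10) = just lower
strategy16 (+ 3) (+ 15) (+ 1) = just lower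
strategy16 (+ 3) (+ 15) (+ 3) = just lower
strategy16 (+ 3) (+ 15) (+ 5) = just lower
strategy16 (+ 3) (+ 15) (+ 7) = just upper
strategy16 (+ 3) (+ 15) (+ 9) = just lower
strategy16 (+ 3) (+ 15) (+ 11) = just lower
strategy16 (+ 3) (+ 15) (+ 13) = just lower
strategy16 (+ 3) (+ 15) (+ 15) = just upper
strategy16 (+ 4) (+ 0) (+ 0) = just lower
strategy16 (+ 4) (+ 0) (+ 8) = just lower
strategy16 (+ 4) (+ 1) (+ 12) = just lower
strategy16 (+ 4) (+ 2) (+ 0) = just upper
strategy16 (+ 4) (+ 3) (+ 4) = just lower
strategy16 (+ 4) (+ 3) (+ 12) = just upper
strategy16 (+ 4) (+ 4) (+ 0) = just upper
strategy16 (+ 4) (+ 5) (+ 4) = just upper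
strategy16 (+ 4) (+ 5) (+ 12) = just lower
strategy16 (+ 4) (+ 6) (+ 0) = just lower
strategy16 (+ 4) (+ 7) (+ 4) = just lower
strategy16 (+ 4) (+ 7) (+ 12) = just upper
strategy16 (+ 4) (+ 8) (+ 0) = just lower
strategy16 (+ 4) (+ 9) (+ 4) = just lower
strategy16 (+ 4) (+ 9) (+ 12) = just lower
strategy16 (+ 4) (+ 10) (+ 0) = just lower
strategy16 (+ 4) (+ 10) (+ 8) = just upper
strategy16 (+ 4) (+ 11) (+ 4) = just lower
strategy16 (+ 4) (+ 11) (+ 12) = just lower
strategy16 (+ 4) (+ 12) (+ 0) = just lower
strategy16 (+ 4) (+ 12) (+ 8) = just upper
strategy16 (+ 4) (+ 13) (+ 4) = just upper
strategy16 (+ 4) (+ 13) (+ 12) = just lower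
strategy16 (+ 4) (+ 14) (+ 0) = just lower
strategy16 (+ 4) (+ 14) (+ 8) = just lower
strategy16 (+ 4) (+ 15) (+ 4) = just lower
strategy16 (+ 4) (+ 15) (+ 12) = just lower
strategy16 (+ 5) (+ 0) (+ 0) = just lower
strategy16 (+ 5) (+ 0) (+ 8) = just lower
strategy16 (+ 5) (+ 1) (+ 1) = just upper
strategy16 (+ 5) (+ 1) (+ 3) = just lower
strategy16 (+ 5) (+ 1) (+ 5) = just lower
strategy16 (+ 5) (+ 1) (+ 7) = just upper
strategy16 (+ 5) (+ 1) (+ 9) = just lower
strategy16 (+ 5) (+ 1) (+ 11) = just upper
strategy16 (+ 5) (+ 1) (+ 13) = just upper
strategy16 (+ 5) (+ 1) (+ 15) = just upper
strategy16 (+ 5) (+ 2) (+ 6) = just lower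
strategy16 (+ 5) (+ 2) (+ 10) = just upper
strategy16 (+ 5) (+ 3) (+ 0) = just lower
strategy16 (+ 5) (+ 3) (+ 1) = just upper
strategy16 (+ 5) (+ 3) (+ 2) = just upper
strategy16 (+ 5) (+ 3) (+ 3) = just upper
strategy16 (+ 5) (+ 3) (+ 4) = just upper
strategy16 (+ 5) (+ 3) (+ 5) = just lower
strategy16 (+ 5) (+ 3) (+ 7) = just upper
strategy16 (+ 5) (+ 3) (+ 8) = just lower
strategy16 (+ 5) (+ 3) (+ 9) = just lower
strategy16 (+ 5) (+ 3) (+ 10) = just upper
strategy16 (+ 5) (+ 3) (+ 11) = just lower
strategy16 (+ 5) (+ 3) (+ 12) = just upper
strategy16 (+ 5) (+ 3) (+ 13) = just lower
strategy16 (+ 5) (+ 3) (+ 14) = just lower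
strategy16 (+ 5) (+ 3) (+ 15) = just lower
strategy16 (+ 5) (+ 4) (+ 4) = just upper
strategy16 (+ 5) (+ 4) (+ 12) = just lower
strategy16 (+ 5) (+ 5) (+ 1) = just lower
strategy16 (+ 5) (+ 5) (+ 3) = just upper
strategy16 (+ 5) (+ 5) (+ 5) = just lower
strategy16 (+ 5) (+ 5) (+ 7) = just upper
strategy16 (+ 5) (+ 5) (+ 9) = just lower
strategy16 (+ 5) (+ 5) (+ 11) = just upper
strategy16 (+ 5) (+ 5) (+ 13) = just lower
strategy16 (+ 5) (+ 5) (+ 15) = just upper
strategy16 (+ 5) (+ 6) (+ 2) = just upper
strategy16 (+ 5) (+ 6) (+ 14) = just lower
strategy16 (+ 5) (+ 7) (+ 0) = just lower
strategy16 (+ 5) (+ 7) (+ 1) = just lower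
strategy16 (+ 5) (+ 7) (+ 3) = just upper
strategy16 (+ 5) (+ 7) (+ 5) = just lower
strategy16 (+ 5) (+ 7) (+ 7) = just upper
strategy16 (+ 5) (+ 7) (+ 8) = just lower
strategy16 (+ 5) (+ 7) (+ 9) = just upper
strategy16 (+ 5) (+ 7) (+ 11) = just lower
strategy16 (+ 5) (+ 7) (+ 13) = just lower
strategy16 (+ 5) (+ 7) (+ 15) = just upper
strategy16 (+ 5) (+ 8) (+ 0) = just lower
strategy16 (+ 5) (+ 8) (+ 8) = just lower
strategy16 (+ 5) (+ 9) (+ 1) = just lower
strategy16 (+ 5) (+ 9) (+ 3) = just lower
strategy16 (+ 5) (+ 9) (+ 5) = just upper
strategy16 (+ 5) (+ 9) (+ 7) = just upper
strategy16 (+ 5) (+ 9) (+ 9) = just lower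
strategy16 (+ 5) (+ 9) (+ 11) = just lower
strategy16 (+ 5) (+ 9) (+ 13) = just upper
strategy16 (+ 5) (+ 9) (+ 15) = just lower
strategy16 (+ 5) (+ 10) (+ 2) = just lower
strategy16 (+ 5) (+ 10) (+ 14) = just upper
strategy16 (+ 5) (+ 11) (+ 1) = just upper
strategy16 (+ 5) (+ 11) (+ 2) = just lower
strategy16 (+ 5) (+ 11) (+ 3) = just lower
strategy16 (+ 5) (+ 11) (+ 5) = just upper
strategy16 (+ 5) (+ 11) (+ 6) = just upper
strategy16 (+ 5) (+ 11) (+ 7) = just upper
strategy16 (+ 5) (+ 11) (+ 9) = just upper
strategy16 (+ 5) (+ 11) (+ 10) = just upper
strategy16 (+ 5) (+ 11) (+ 11) = just upper
strategy16 (+ 5) (+ 11) (+ 13) = just lower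
strategy16 (+ 5) (+ 11) (+ 14) = just lower
strategy16 (+ 5) (+ 11) (+ 15) = just upper
strategy16 (+ 5) (+ 12) (+ 4) = just upper
strategy16 (+ 5) (+ 12) (+ 12) = just upper
strategy16 (+ 5) (+ 13) (+ 1) = just lower
strategy16 (+ 5) (+ 13) (+ 3) = just upper
strategy16 (+ 5) (+ 13) (+ 5) = just upper
strategy16 (+ 5) (+ 13) (+ 7) = just upper
strategy16 (+ 5) (+ 13) (+ 9) = just lower
strategy16 (+ 5) (+ 13) (+ 11) = just lower
strategy16 (+ 5) (+ 13) (+ 13) = just upper
strategy16 (+ 5) (+ 13) (+ 15) = just lower
strategy16 (+ 5) (+ 14) (+ 6) = just upper
strategy16 (+ 5) (+ 14) (+ 10) = just upper
strategy16 (+ 5) (+ 15) (+ 1) = just upper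
strategy16 (+ 5) (+ 15) (+ 3) = just upper
strategy16 (+ 5) (+ 15) (+ 4) = just lower
strategy16 (+ 5) (+ 15) (+ 5) = just lower
strategy16 (+ 5) (+ 15) (+ 7) = just lower
strategy16 (+ 5) (+ 15) (+ 9) = just lower
strategy16 (+ 5) (+ 15) (+ 11) = just upper
strategy16 (+ 5) (+ 15) (+ 12) = just upper
strategy16 (+ 5) (+ 15) (+ 13) = just lower
strategy16 (+ 5) (+ 15) (+ 15) = just lower
strategy16 (+ 6) (+ 0) (+ 0) = just lower
strategy16 (+ 6) (+ 0) (+ 8) = just lower
strategy16 (+ 6) (+ 1) (+ 6) = just upper
strategy16 (+ 6) (+ 1) (+ 10) = just lower
strategy16 (+ 6) (+ 2) (+ 4) = just upper
strategy16 (+ 6) (+ 2) (+ 12) = just upper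
strategy16 (+ 6) (+ 3) (+ 2) = just upper
strategy16 (+ 6) (+ 3) (+ 14) = just lower
strategy16 (+ 6) (+ 4) (+ 0) = just upper
strategy16 (+ 6) (+ 4) (+ 8) = just lower
strategy16 (+ 6) (+ 5) (+ 2) = just upper
strategy16 (+ 6) (+ 5) (+ 14) = just upper
strategy16 (+ 6) (+ 6) (+ 4) = just upper
strategy16 (+ 6) (+ 6) (+ 12) = just upper
strategy16 (+ 6) (+ 7) (+ 6) = just lower
strategy16 (+ 6) (+ 7) (+ 10) = just upper
strategy16 (+ 6) (+ 8) (+ 0) = just lower
strategy16 (+ 6) (+ 8) (+ 8) = just lower
strategy16 (+ 6) (+ 9) (+ 6) = just upper
strategy16 (+ 6) (+ 9) (+ 10) = just lower
strategy16 (+ 6) (+ 10) (+ 4) = just upper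
strategy16 (+ 6) (+ 10) (+ 12) = just lower
strategy16 (+ 6) (+ 11) (+ 2) = just upper
strategy16 (+ 6) (+ 11) (+ 14) = just upper
strategy16 (+ 6) (+ 12) (+ 0) = just lower
strategy16 (+ 6) (+ 12) (+ 8) = just upper
strategy16 (+ 6) (+ 13) (+ 2) = just upper
strategy16 (+ 6) (+ 13) (+ 14) = just lower
strategy16 (+ 6) (+ 14) (+ 4) = just lower
strategy16 (+ 6) (+ 14) (+ 12) = just lower
strategy16 (+ 6) (+ 15) (+ 6) = just upper
strategy16 (+ 6) (+ 15) (+ 10) = just upper
strategy16 (+ 7) (+ 0) (+ 0) = just lower
strategy16 (+ 7) (+ 0) (+ 8) = just lower
strategy16 (+ 7) (+ 1) (+ 1) = just lower
strategy16 (+ 7) (+ 1) (+ 2) = just lower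
strategy16 (+ 7) (+ 1) (+ 3) = just lower
strategy16 (+ 7) (+ 1) (+ 5) = just lower
strategy16 (+ 7) (+ 1) (+ 6) = just upper
strategy16 (+ 7) (+ 1) (+ 7) = just upper
strategy16 (+ 7) (+ 1) (+ 9) = just lower
strategy16 (+ 7) (+ 1) (+ 10) = just upper
strategy16 (+ 7) (+ 1) (+ 11) = just upper
strategy16 (+ 7) (+ 1) (+ 13) = just upper
strategy16 (+ 7) (+ 1) (+ 14) = just upper
strategy16 (+ 7) (+ 1) (+ 15) = just upper
strategy16 (+ 7) (+ 2) (+ 2) = just upper
strategy16 (+ 7) (+ 2) (+ 14) = just upper
strategy16 (+ 7) (+ 3) (+ 1) = just lower
strategy16 (+ 7) (+ 3) (+ 3) = just lower
strategy16 (+ 7) (+ 3) (+ 5) = just upper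
strategy16 (+ 7) (+ 3) (+ 7) = just upper
strategy16 (+ 7) (+ 3) (+ 9) = just lower
strategy16 (+ 7) (+ 3) (+ 11) = just upper
strategy16 (+ 7) (+ 3) (+ 13) = just upper
strategy16 (+ 7) (+ 3) (+ 15) = just upper
strategy16 (+ 7) (+ 4) (+ 4) = just upper
strategy16 (+ 7) (+ 4) (+ 12) = just upper
strategy16 (+ 7) (+ 5) (+ 0) = just upper
strategy16 (+ 7) (+ 5) (+ 1) = just lower
strategy16 (+ 7) (+ 5) (+ 3) = just upper
strategy16 (+ 7) (+ 5) (+ 5) = just upper
strategy16 (+ 7) (+ 5) (+ 7) = just upper
strategy16 (+ 7) (+ 5) (+ 8) = just upper
strategy16 (+ 7) (+ 5) (+ 9) = just lower
strategy16 (+ 7) (+ 5) (+ 11) = just upper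
strategy16 (+ 7) (+ 5) (+ 13) = just lower
strategy16 (+ 7) (+ 5) (+ 15) = just upper
strategy16 (+ 7) (+ 6) (+ 6) = just upper
strategy16 (+ 7) (+ 6) (+ 10) = just upper
strategy16 (+ 7) (+ 7) (+ 1) = just upper
strategy16 (+ 7) (+ 7) (+ 3) = just upper
strategy16 (+ 7) (+ 7) (+ 5) = just lower
strategy16 (+ 7) (+ 7) (+ 7) = just lower
strategy16 (+ 7) (+ 7) (+ 9) = just upper
strategy16 (+ 7) (+ 7) (+ 11) = just upper
strategy16 (+ 7) (+ 7) (+ 13) = just lower
strategy16 (+ 7) (+ 7) (+ 15) = just lower
strategy16 (+ 7) (+ 8) (+ 0) = just lower
strategy16 (+ 7) (+ 8) (+ 8) = just lower
strategy16 (+ 7) (+ 9) (+ 0) = just lower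
strategy16 (+ 7) (+ 9) (+ 1) = just upper
strategy16 (+ 7) (+ 9) (+ 2) = just upper
strategy16 (+ 7) (+ 9) (+ 3) = just lower
strategy16 (+ 7) (+ 9) (+ 4) = just upper
strategy16 (+ 7) (+ 9) (+ 5) = just upper
strategy16 (+ 7) (+ 9) (+ 6) = just upper
strategy16 (+ 7) (+ 9) (+ 7) = just upper
strategy16 (+ 7) (+ 9) (+ 8) = just upper
strategy16 (+ 7) (+ 9) (+ 9) = just upper
strategy16 (+ 7) (+ 9) (+ 10) = just lower
strategy16 (+ 7) (+ 9) (+ 11) = just lower
strategy16 (+ 7) (+ 9) (+ 12) = just upper
strategy16 (+ 7) (+ 9) (+ 13) = just lower
strategy16 (+ 7) (+ 9) (+ 14) = just upper
strategy16 (+ 7) (+ 9) (+ 15) = just upper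
strategy16 (+ 7) (+ 10) (+ 6) = just upper
strategy16 (+ 7) (+ 10) (+ 10) = just upper
strategy16 (+ 7) (+ 11) (+ 1) = just lower
strategy16 (+ 7) (+ 11) (+ 3) = just upper
strategy16 (+ 7) (+ 11) (+ 5) = just lower
strategy16 (+ 7) (+ 11) (+ 7) = just lower
strategy16 (+ 7) (+ 11) (+ 9) = just upper
strategy16 (+ 7) (+ 11) (+ 11) = just upper
strategy16 (+ 7) (+ 11) (+ 13) = just lower
strategy16 (+ 7) (+ 11) (+ 15) = just upper
strategy16 (+ 7) (+ 12) (+ 4) = just upper
strategy16 (+ 7) (+ 12) (+ 12) = just upper
strategy16 (+ 7) (+ 13) (+ 1) = just upper
strategy16 (+ 7) (+ 13) (+ 3) = just upper
strategy16 (+ 7) (+ 13) (+ 4) = just lower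
strategy16 (+ 7) (+ 13) (+ 5) = just upper
strategy16 (+ 7) (+ 13) (+ 7) = just lower
strategy16 (+ 7) (+ 13) (+ 9) = just upper
strategy16 (+ 7) (+ 13) (+ 11) = just lower
strategy16 (+ 7) (+ 13) (+ 12) = just upper
strategy16 (+ 7) (+ 13) (+ 13) = just upper
strategy16 (+ 7) (+ 13) (+ 15) = just lower
strategy16 (+ 7) (+ 14) (+ 2) = just upper
strategy16 (+ 7) (+ 14) (+ 14) = just upper
strategy16 (+ 7) (+ 15) (+ 1) = just upper
strategy16 (+ 7) (+ 15) (+ 3) = just lower
strategy16 (+ 7) (+ 15) (+ 5) = just upper
strategy16 (+ 7) (+ 15) (+ 7) = just lower
strategy16 (+ 7) (+ 15) (+ 9) = just lower
strategy16 (+ 7) (+ 15) (+ 11) = just lower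
strategy16 (+ 7) (+ 15) (+ 13) = just upper
strategy16 (+ 7) (+ 15) (+ 15) = just upper
strategy16 (+ 8) (+ 0) (+ 0) = just lower
strategy16 (+ 8) (+ 0) (+ 8) = just upper
strategy16 (+ 8) (+ 1) (+ 0) = just upper
strategy16 (+ 8) (+ 1) (+ 8) = just upper
strategy16 (+ 8) (+ 2) (+ 0) = just upper
strategy16 (+ 8) (+ 2) (+ 8) = just upper
strategy16 (+ 8) (+ 3) (+ 0) = just upper
strategy16 (+ 8) (+ 3) (+ 8) = just upper
strategy16 (+ 8) (+ 4) (+ 0) = just upper
strategy16 (+ 8) (+ 5) (+ 0) = just upper
strategy16 (+ 8) (+ 5) (+ 8) = just upper
strategy16 (+ 8) (+ 6) (+ 0) = just upper
strategy16 (+ 8) (+ 6) (+ 8) = just upper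
strategy16 (+ 8) (+ 7) (+ 0) = just upper
strategy16 (+ 8) (+ 7) (+ 8) = just upper
strategy16 (+ 8) (+ 8) (+ 0) = just upper
strategy16 (+ 8) (+ 9) (+ 0) = just lower
strategy16 (+ 8) (+ 9) (+ 8) = just upper
strategy16 (+ 8) (+ 10) (+ 0) = just lower
strategy16 (+ 8) (+ 10) (+ 8) = just upper
strategy16 (+ 8) (+ 11) (+ 0) = just lower
strategy16 (+ 8) (+ 11) (+ 8) = just upper
strategy16 (+ 8) (+ 12) (+ 0) = just lower
strategy16 (+ 8) (+ 12) (+ 8) = just upper
strategy16 (+ 8) (+ 13) (+ 0) = just lower
strategy16 (+ 8) (+ 13) (+ 8) = just upper
strategy16 (+ 8) (+ 14) (+ 0) = just upper
strategy16 (+ 8) (+ 14) (+ 8) = just upper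
strategy16 (+ 8) (+ 15) (+ 0) = just lower
strategy16 (+ 8) (+ 15) (+ 8) = just upper
strategy16 (+ 9) (+ 0) (+ 0) = just lower
strategy16 (+ 9) (+ 0) (+ 8) = just lower
strategy16 (+ 9) (+ 1) (+ 1) = just upper
strategy16 (+ 9) (+ 1) (+ 3) = just lower
strategy16 (+ 9) (+ 1) (+ 5) = just lower
strategy16 (+ 9) (+ 1) (+ 7) = just lower
strategy16 (+ 9) (+ 1) (+ 9) = just upper
strategy16 (+ 9) (+ 1) (+ 11) = just upper
strategy16 (+ 9) (+ 1) (+ 13) = just upper
strategy16 (+ 9) (+ 1) (+ 15) = just upper
strategy16 (+ 9) (+ 2) (+ 2) = just upper
strategy16 (+ 9) (+ 2) (+ 14) = just upper
strategy16 (+ 9) (+ 3) (+ 1) = just upper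
strategy16 (+ 9) (+ 3) (+ 3) = just upper
strategy16 (+ 9) (+ 3) (+ 4) = just upper
strategy16 (+ 9) (+ 3) (+ 5) = just lower
strategy16 (+ 9) (+ 3) (+ 7) = just upper
strategy16 (+ 9) (+ 3) (+ 9) = just lower
strategy16 (+ 9) (+ 3) (+ 11) = just upper
strategy16 (+ 9) (+ 3) (+ 12) = just upper
strategy16 (+ 9) (+ 3) (+ 13) = just lower
strategy16 (+ 9) (+ 3) (+ 15) = just lower
strategy16 (+ 9) (+ 4) (+ 4) = just upper
strategy16 (+ 9) (+ 4) (+ 12) = just upper
strategy16 (+ 9) (+ 5) (+ 1) = just lower
strategy16 (+ 9) (+ 5) (+ 3) = just upper
strategy16 (+ 9) (+ 5) (+ 5) = just upper
strategy16 (+ 9) (+ 5) (+ 7) = just upper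
strategy16 (+ 9) (+ 5) (+ 9) = just lower
strategy16 (+ 9) (+ 5) (+ 11) = just lower
strategy16 (+ 9) (+ 5) (+ 13) = just upper
strategy16 (+ 9) (+ 5) (+ 15) = just upper
strategy16 (+ 9) (+ 6) (+ 6) = just upper
strategy16 (+ 9) (+ 6) (+ 10) = just upper
strategy16 (+ 9) (+ 7) (+ 0) = just upper
strategy16 (+ 9) (+ 7) (+ 1) = just upper
strategy16 (+ 9) (+ 7) (+ 2) = just upper
strategy16 (+ 9) (+ 7) (+ 3) = just lower
strategy16 (+ 9) (+ 7) (+ 4) = just upper
strategy16 (+ 9) (+ 7) (+ 5) = just upper
strategy16 (+ 9) (+ 7) (+ 6) = just lower
strategy16 (+ 9) (+ 7) (+ 7) = just upper
strategy16 (+ 9) (+ 7) (+ 8) = just lower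
strategy16 (+ 9) (+ 7) (+ 9) = just upper
strategy16 (+ 9) (+ 7) (+ 10) = just lower
strategy16 (+ 9) (+ 7) (+ 11) = just upper
strategy16 (+ 9) (+ 7) (+ 12) = just lower
strategy16 (+ 9) (+ 7) (+ 13) = just lower
strategy16 (+ 9) (+ 7) (+ 14) = just upper
strategy16 (+ 9) (+ 7) (+ 15) = just upper
strategy16 (+ 9) (+ 8) (+ 0) = just upper
strategy16 (+ 9) (+ 8) (+ 8) = just lower
strategy16 (+ 9) (+ 9) (+ 1) = just lower
strategy16 (+ 9) (+ 9) (+ 3) = just lower
strategy16 (+ 9) (+ 9) (+ 5) = just lower
strategy16 (+ 9) (+ 9) (+ 7) = just upper
strategy16 (+ 9) (+ 9) (+ 9) = just lower
strategy16 (+ 9) (+ 9) (+ 11) = just lower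
strategy16 (+ 9) (+ 9) (+ 13) = just upper
strategy16 (+ 9) (+ 9) (+ 15) = just upper
strategy16 (+ 9) (+ 10) (+ 6) = just lower
strategy16 (+ 9) (+ 10) (+ 10) = just lower
strategy16 (+ 9) (+ 11) (+ 0) = just upper
strategy16 (+ 9) (+ 11) (+ 1) = just upper
strategy16 (+ 9) (+ 11) (+ 3) = just lower
strategy16 (+ 9) (+ 11) (+ 5) = just upper
strategy16 (+ 9) (+ 11) (+ 7) = just lower
strategy16 (+ 9) (+ 11) (+ 8) = just upper
strategy16 (+ 9) (+ 11) (+ 9) = just lower
strategy16 (+ 9) (+ 11) (+ 11) = just upper
strategy16 (+ 9) (+ 11) (+ 13) = just lower
strategy16 (+ 9) (+ 11) (+ 15) = just lower
strategy16 (+ 9) (+ 12) (+ 4) = just upper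
strategy16 (+ 9) (+ 12) (+ 12) = just lower
strategy16 (+ 9) (+ 13) (+ 1) = just upper
strategy16 (+ 9) (+ 13) (+ 3) = just lower
strategy16 (+ 9) (+ 13) (+ 5) = just upper
strategy16 (+ 9) (+ 13) (+ 7) = just lower
strategy16 (+ 9) (+ 13) (+ 9) = just upper
strategy16 (+ 9) (+ 13) (+ 11) = just lower
strategy16 (+ 9) (+ 13) (+ 13) = just lower
strategy16 (+ 9) (+ 13) (+ 15) = just lower
strategy16 (+ 9) (+ 14) (+ 2) = just upper
strategy16 (+ 9) (+ 14) (+ 14) = just upper
strategy16 (+ 9) (+ 15) (+ 1) = just lower
strategy16 (+ 9) (+ 15) (+ 2) = just lower
strategy16 (+ 9) (+ 15) (+ 3) = just upper
strategy16 (+ 9) (+ 15) (+ 5) = just lower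
strategy16 (+ 9) (+ 15) (+ 6) = just lower
strategy16 (+ 9) (+ 15) (+ 7) = just lower
strategy16 (+ 9) (+ 15) (+ 9) = just lower
strategy16 (+ 9) (+ 15) (+ 10) = just lower
strategy16 (+ 9) (+ 15) (+ 11) = just upper
strategy16 (+ 9) (+ 15) (+ 13) = just lower
strategy16 (+ 9) (+ 15) (+ 14) = just upper
strategy16 (+ 9) (+ 15) (+ 15) = just lower
strategy16 (+ 10) (+ 0) (+ 0) = just lower
strategy16 (+ 10) (+ 0) (+ 8) = just lower
strategy16 (+ 10) (+ 1) (+ 6) = just upper
strategy16 (+ 10) (+ 1) (+ 10) = just upper
strategy16 (+ 10) (+ 2) (+ 4) = just lower
strategy16 (+ 10) (+ 2) (+ 12) = just upper
strategy16 (+ 10) (+ 3) (+ 2) = just upper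
strategy16 (+ 10) (+ 3) (+ 14) = just upper
strategy16 (+ 10) (+ 4) (+ 0) = just upper
strategy16 (+ 10) (+ 4) (+ 8) = just lower
strategy16 (+ 10) (+ 5) (+ 2) = just upper
strategy16 (+ 10) (+ 5) (+ 14) = just lower
strategy16 (+ 10) (+ 6) (+ 4) = just lower
strategy16 (+ 10) (+ 6) (+ 12) = just upper
strategy16 (+ 10) (+ 7) (+ 6) = just lower
strategy16 (+ 10) (+ 7) (+ 10) = just lower
strategy16 (+ 10) (+ 8) (+ 0) = just lower
strategy16 (+ 10) (+ 8) (+ 8) = just lower
strategy16 (+ 10) (+ 9) (+ 6) = just lower
strategy16 (+ 10) (+ 9) (+ 10) = just lower
strategy16 (+ 10) (+ 10) (+ 4) = just upper
strategy16 (+ 10) (+ 10) (+ 12) = just upper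
strategy16 (+ 10) (+ 11) (+ 2) = just upper
strategy16 (+ 10) (+ 11) (+ 14) = just lower
strategy16 (+ 10) (+ 12) (+ 0) = just lower
strategy16 (+ 10) (+ 12) (+ 8) = just upper
strategy16 (+ 10) (+ 13) (+ 2) = just lower
strategy16 (+ 10) (+ 13) (+ 14) = just upper
strategy16 (+ 10) (+ 14) (+ 4) = just upper
strategy16 (+ 10) (+ 14) (+ 12) = just lower
strategy16 (+ 10) (+ 15) (+ 6) = just upper
strategy16 (+ 10) (+ 15) (+ 10) = just upper
strategy16 (+ 11) (+ 0) (+ 0) = just lower
strategy16 (+ 11) (+ 0) (+ 8) = just lower
strategy16 (+ 11) (+ 1) (+ 1) = just upper
strategy16 (+ 11) (+ 1) (+ 3) = just lower
strategy16 (+ 11) (+ 1) (+ 4) = just lower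
strategy16 (+ 11) (+ 1) (+ 5) = just upper
strategy16 (+ 11) (+ 1) (+ 7) = just upper
strategy16 (+ 11) (+ 1) (+ 9) = just lower
strategy16 (+ 11) (+ 1) (+ 11) = just lower
strategy16 (+ 11) (+ 1) (+ 12) = just upper
strategy16 (+ 11) (+ 1) (+ 13) = just upper
strategy16 (+ 11) (+ 1) (+ 15) = just upper
strategy16 (+ 11) (+ 2) (+ 6) = just upper
strategy16 (+ 11) (+ 2) (+ 10) = just upper
strategy16 (+ 11) (+ 3) (+ 1) = just lower
strategy16 (+ 11) (+ 3) (+ 3) = just upper
strategy16 (+ 11) (+ 3) (+ 5) = just lower
strategy16 (+ 11) (+ 3) (+ 7) = just lower
strategy16 (+ 11) (+ 3) (+ 9) = just upper
strategy16 (+ 11) (+ 3) (+ 11) = just lower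
strategy16 (+ 11) (+ 3) (+ 13) = just upper
strategy16 (+ 11) (+ 3) (+ 15) = just lower
strategy16 (+ 11) (+ 4) (+ 4) = just lower
strategy16 (+ 11) (+ 4) (+ 12) = just upper
strategy16 (+ 11) (+ 5) (+ 1) = just upper
strategy16 (+ 11) (+ 5) (+ 2) = just upper
strategy16 (+ 11) (+ 5) (+ 3) = just lower
strategy16 (+ 11) (+ 5) (+ 5) = just upper
strategy16 (+ 11) (+ 5) (+ 6) = just lower
strategy16 (+ 11) (+ 5) (+ 7) = just upper
strategy16 (+ 11) (+ 5) (+ 9) = just upper
strategy16 (+ 11) (+ 5) (+ 10) = just upper
strategy16 (+ 11) (+ 5) (+ 11) = just upper
strategy16 (+ 11) (+ 5) (+ 13) = just lower
strategy16 (+ 11) (+ 5) (+ 14) = just upper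
strategy16 (+ 11) (+ 5) (+ 15) = just lower
strategy16 (+ 11) (+ 6) (+ 2) = just lower
strategy16 (+ 11) (+ 6) (+ 14) = just upper
strategy16 (+ 11) (+ 7) (+ 1) = just upper
strategy16 (+ 11) (+ 7) (+ 3) = just lower
strategy16 (+ 11) (+ 7) (+ 5) = just lower
strategy16 (+ 11) (+ 7) (+ 7) = just lower
strategy16 (+ 11) (+ 7) (+ 9) = just upper
strategy16 (+ 11) (+ 7) (+ 11) = just upper
strategy16 (+ 11) (+ 7) (+ 13) = just upper
strategy16 (+ 11) (+ 7) (+ 15) = just lower
strategy16 (+ 11) (+ 8) (+ 0) = just upper
strategy16 (+ 11) (+ 8) (+ 8) = just lower
strategy16 (+ 11) (+ 9) (+ 0) = just lower
strategy16 (+ 11) (+ 9) (+ 1) = just upper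
strategy16 (+ 11) (+ 9) (+ 3) = just lower
strategy16 (+ 11) (+ 9) (+ 5) = just lower
strategy16 (+ 11) (+ 9) (+ 7) = just lower
strategy16 (+ 11) (+ 9) (+ 8) = just lower
strategy16 (+ 11) (+ 9) (+ 9) = just upper
strategy16 (+ 11) (+ 9) (+ 11) = just lower
strategy16 (+ 11) (+ 9) (+ 13) = just upper
strategy16 (+ 11) (+ 9) (+ 15) = just lower
strategy16 (+ 11) (+ 10) (+ 2) = just lower
strategy16 (+ 11) (+ 10) (+ 14) = just lower
strategy16 (+ 11) (+ 11) (+ 1) = just upper
strategy16 (+ 11) (+ 11) (+ 3) = just lower
strategy16 (+ 11) (+ 11) (+ 5) = just upper
strategy16 (+ 11) (+ 11) (+ 7) = just lower
strategy16 (+ 11) (+ 11) (+ 9) = just upper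
strategy16 (+ 11) (+ 11) (+ 11) = just lower
strategy16 (+ 11) (+ 11) (+ 13) = just upper
strategy16 (+ 11) (+ 11) (+ 15) = just lower
strategy16 (+ 11) (+ 12) (+ 4) = just lower
strategy16 (+ 11) (+ 12) (+ 12) = just upper
strategy16 (+ 11) (+ 13) (+ 0) = just lower
strategy16 (+ 11) (+ 13) (+ 1) = just lower
strategy16 (+ 11) (+ 13) (+ 2) = just upper
strategy16 (+ 11) (+ 13) (+ 3) = just lower
strategy16 (+ 11) (+ 13) (+ 4) = just upper
strategy16 (+ 11) (+ 13) (+ 5) = just lower
strategy16 (+ 11) (+ 13) (+ 6) = just lower
strategy16 (+ 11) (+ 13) (+ 7) = just lower
strategy16 (+ 11) (+ 13) (+ 8) = just lower
strategy16 (+ 11) (+ 13) (+ 9) = just upper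
strategy16 (+ 11) (+ 13) (+ 10) = just upper
strategy16 (+ 11) (+ 13) (+ 11) = just lower
strategy16 (+ 11) (+ 13) (+ 12) = just upper
strategy16 (+ 11) (+ 13) (+ 13) = just upper
strategy16 (+ 11) (+ 13) (+ 14) = just lower
strategy16 (+ 11) (+ 13) (+ 15) = just lower
strategy16 (+ 11) (+ 14) (+ 6) = just upper
strategy16 (+ 11) (+ 14) (+ 10) = just lower
strategy16 (+ 11) (+ 15) (+ 1) = just upper
strategy16 (+ 11) (+ 15) (+ 3) = just lower
strategy16 (+ 11) (+ 15) (+ 5) = just upper
strategy16 (+ 11) (+ 15) (+ 7) = just lower
strategy16 (+ 11) (+ 15) (+ 9) = just upper
strategy16 (+ 11) (+ 15) (+ 11) = just lower
strategy16 (+ 11) (+ 15) (+ 13) = just upper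
strategy16 (+ 11) (+ 15) (+ 15) = just upper
strategy16 (+ 12) (+ 0) (+ 0) = just lower
strategy16 (+ 12) (+ 0) (+ 8) = just lower
strategy16 (+ 12) (+ 1) (+ 4) = just upper
strategy16 (+ 12) (+ 1) (+ 12) = just lower
strategy16 (+ 12) (+ 2) (+ 0) = just upper
strategy16 (+ 12) (+ 2) (+ 8) = just upper
strategy16 (+ 12) (+ 3) (+ 4) = just lower
strategy16 (+ 12) (+ 3) (+ 12) = just upper
strategy16 (+ 12) (+ 4) (+ 0) = just upper
strategy16 (+ 12) (+ 4) (+ 8) = just upper
strategy16 (+ 12) (+ 5) (+ 4) = just upper
strategy16 (+ 12) (+ 5) (+ 12) = just lower
strategy16 (+ 12) (+ 6) (+ 0) = just upper
strategy16 (+ 12) (+ 6) (+ 8) = just upper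
strategy16 (+ 12) (+ 7) (+ 4) = just lower
strategy16 (+ 12) (+ 7) (+ 12) = just upper
strategy16 (+ 12) (+ 8) (+ 0) = just upper
strategy16 (+ 12) (+ 8) (+ 8) = just lower
strategy16 (+ 12) (+ 9) (+ 4) = just lower
strategy16 (+ 12) (+ 9) (+ 12) = just lower
strategy16 (+ 12) (+ 10) (+ 0) = just upper
strategy16 (+ 12) (+ 10) (+ 8) = just lower
strategy16 (+ 12) (+ 11) (+ 4) = just lower
strategy16 (+ 12) (+ 11) (+ 12) = just lower
strategy16 (+ 12) (+ 12) (+ 0) = just upper
strategy16 (+ 12) (+ 12) (+ 8) = just lower
strategy16 (+ 12) (+ 13) (+ 4) = just lower
strategy16 (+ 12) (+ 13) (+ 12) = just lower
strategy16 (+ 12) (+ 14) (+ 0) = just lower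
strategy16 (+ 12) (+ 14) (+ 8) = just upper
strategy16 (+ 12) (+ 15) (+ 4) = just lower
strategy16 (+ 12) (+ 15) (+ 12) = just upper
strategy16 (+ 13) (+ 0) (+ 0) = just lower
strategy16 (+ 13) (+ 0) (+ 8) = just lower
strategy16 (+ 13) (+ 1) (+ 1) = just upper
strategy16 (+ 13) (+ 1) (+ 3) = just lower
strategy16 (+ 13) (+ 1) (+ 5) = just upper
strategy16 (+ 13) (+ 1) (+ 7) = just lower
strategy16 (+ 13) (+ 1) (+ 9) = just upper
strategy16 (+ 13) (+ 1) (+ 11) = just upper
strategy16 (+ 13) (+ 1) (+ 13) = just upper
strategy16 (+ 13) (+ 1) (+ 15) = just upper
strategy16 (+ 13) (+ 2) (+ 6) = just upper
strategy16 (+ 13) (+ 2) (+ 10) = just upper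
strategy16 (+ 13) (+ 3) (+ 1) = just upper
strategy16 (+ 13) (+ 3) (+ 2) = just upper
strategy16 (+ 13) (+ 3) (+ 3) = just upper
strategy16 (+ 13) (+ 3) (+ 5) = just lower
strategy16 (+ 13) (+ 3) (+ 6) = just upper
strategy16 (+ 13) (+ 3) (+ 7) = just upper
strategy16 (+ 13) (+ 3) (+ 9) = just lower
strategy16 (+ 13) (+ 3) (+ 10) = just upper
strategy16 (+ 13) (+ 3) (+ 11) = just upper
strategy16 (+ 13) (+ 3) (+ 13) = just lower
strategy16 (+ 13) (+ 3) (+ 14) = just lower
strategy16 (+ 13) (+ 3) (+ 15) = just upper
strategy16 (+ 13) (+ 4) (+ 4) = just upper
strategy16 (+ 13) (+ 4) (+ 12) = just upper
strategy16 (+ 13) (+ 5) (+ 1) = just upper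
strategy16 (+ 13) (+ 5) (+ 3) = just lower
strategy16 (+ 13) (+ 5) (+ 5) = just lower
strategy16 (+ 13) (+ 5) (+ 7) = just upper
strategy16 (+ 13) (+ 5) (+ 9) = just lower
strategy16 (+ 13) (+ 5) (+ 11) = just lower
strategy16 (+ 13) (+ 5) (+ 13) = just lower
strategy16 (+ 13) (+ 5) (+ 15) = just lower
strategy16 (+ 13) (+ 6) (+ 2) = just upper
strategy16 (+ 13) (+ 6) (+ 14) = just upper
strategy16 (+ 13) (+ 7) (+ 1) = just lower
strategy16 (+ 13) (+ 7) (+ 3) = just lower
strategy16 (+ 13) (+ 7) (+ 4) = just lower
strategy16 (+ 13) (+ 7) (+ 5) = just upper
strategy16 (+ 13) (+ 7) (+ 7) = just lower
strategy16 (+ 13) (+ 7) (+ 9) = just upper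
strategy16 (+ 13) (+ 7) (+ 11) = just lower
strategy16 (+ 13) (+ 7) (+ 12) = just lower
strategy16 (+ 13) (+ 7) (+ 13) = just upper
strategy16 (+ 13) (+ 7) (+ 15) = just upper
strategy16 (+ 13) (+ 8) (+ 0) = just upper
strategy16 (+ 13) (+ 8) (+ 8) = just lower
strategy16 (+ 13) (+ 9) (+ 1) = just upper
strategy16 (+ 13) (+ 9) (+ 3) = just lower
strategy16 (+ 13) (+ 9) (+ 5) = just upper
strategy16 (+ 13) (+ 9) (+ 7) = just lower
strategy16 (+ 13) (+ 9) (+ 9) = just upper
strategy16 (+ 13) (+ 9) (+ 11) = just lower
strategy16 (+ 13) (+ 9) (+ 13) = just lower
strategy16 (+ 13) (+ 9) (+ 15) = just lower
strategy16 (+ 13) (+ 10) (+ 2) = just lower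
strategy16 (+ 13) (+ 10) (+ 14) = just lower
strategy16 (+ 13) (+ 11) (+ 0) = just upper
strategy16 (+ 13) (+ 11) (+ 1) = just lower
strategy16 (+ 13) (+ 11) (+ 2) = just lower
strategy16 (+ 13) (+ 11) (+ 3) = just lower
strategy16 (+ 13) (+ 11) (+ 4) = just lower
strategy16 (+ 13) (+ 11) (+ 5) = just upper
strategy16 (+ 13) (+ 11) (+ 6) = just upper
strategy16 (+ 13) (+ 11) (+ 7) = just lower
strategy16 (+ 13) (+ 11) (+ 8) = just upper
strategy16 (+ 13) (+ 11) (+ 9) = just lower
strategy16 (+ 13) (+ 11) (+ 10) = just upper
strategy16 (+ 13) (+ 11) (+ 11) = just upper
strategy16 (+ 13) (+ 11) (+ 12) = just lower
strategy16 (+ 13) (+ 11) (+ 13) = just upper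
strategy16 (+ 13) (+ 11) (+ 14) = just lower
strategy16 (+ 13) (+ 11) (+ 15) = just upper
strategy16 (+ 13) (+ 12) (+ 4) = just upper
strategy16 (+ 13) (+ 12) (+ 12) = just lower
strategy16 (+ 13) (+ 13) (+ 1) = just upper
strategy16 (+ 13) (+ 13) (+ 3) = just lower
strategy16 (+ 13) (+ 13) (+ 5) = just upper
strategy16 (+ 13) (+ 13) (+ 7) = just lower
strategy16 (+ 13) (+ 13) (+ 9) = just upper
strategy16 (+ 13) (+ 13) (+ 11) = just upper
strategy16 (+ 13) (+ 13) (+ 13) = just lower
strategy16 (+ 13) (+ 13) (+ 15) = just lower
strategy16 (+ 13) (+ 14) (+ 6) = just lower
strategy16 (+ 13) (+ 14) (+ 10) = just lower
strategy16 (+ 13) (+ 15) (+ 0) = just lower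
strategy16 (+ 13) (+ 15) (+ 1) = just lower
strategy16 (+ 13) (+ 15) (+ 3) = just upper
strategy16 (+ 13) (+ 15) (+ 5) = just upper
strategy16 (+ 13) (+ 15) (+ 7) = just lower
strategy16 (+ 13) (+ 15) (+ 8) = just lower
strategy16 (+ 13) (+ 15) (+ 9) = just upper
strategy16 (+ 13) (+ 15) (+ 11) = just lower
strategy16 (+ 13) (+ 15) (+ 13) = just lower
strategy16 (+ 13) (+ 15) (+ 15) = just lower
strategy16 (+ 14) (+ 0) (+ 0) = just lower
strategy16 (+ 14) (+ 0) (+ 8) = just lower
strategy16 (+ 14) (+ 1) (+ 2) = just upper
strategy16 (+ 14) (+ 1) (+ 14) = just lower
strategy16 (+ 14) (+ 2) (+ 4) = just upper
strategy16 (+ 14) (+ 2) (+ 12) = just upper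
strategy16 (+ 14) (+ 3) (+ 6) = just upper
strategy16 (+ 14) (+ 3) (+ 10) = just lower
strategy16 (+ 14) (+ 4) (+ 0) = just lower
strategy16 (+ 14) (+ 4) (+ 8) = just upper
strategy16 (+ 14) (+ 5) (+ 6) = just lower
strategy16 (+ 14) (+ 5) (+ 10) = just upper
strategy16 (+ 14) (+ 6) (+ 4) = just lower
strategy16 (+ 14) (+ 6) (+ 12) = just upper
strategy16 (+ 14) (+ 7) (+ 2) = just lower
strategy16 (+ 14) (+ 7) (+ 14) = just upper
strategy16 (+ 14) (+ 8) (+ 0) = just upper
strategy16 (+ 14) (+ 8) (+ 8) = just lower
strategy16 (+ 14) (+ 9) (+ 2) = just upper
strategy16 (+ 14) (+ 9) (+ 14) = just upper
strategy16 (+ 14) (+ 10) (+ 4) = just upper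
strategy16 (+ 14) (+ 10) (+ 12) = just upper
strategy16 (+ 14) (+ 11) (+ 6) = just upper
strategy16 (+ 14) (+ 11) (+ 10) = just lower
strategy16 (+ 14) (+ 12) (+ 0) = just upper
strategy16 (+ 14) (+ 12) (+ 8) = just lower
strategy16 (+ 14) (+ 13) (+ 6) = just lower
strategy16 (+ 14) (+ 13) (+ 10) = just lower
strategy16 (+ 14) (+ 14) (+ 4) = just lower
strategy16 (+ 14) (+ 14) (+ 12) = just lower
strategy16 (+ 14) (+ 15) (+ 2) = just upper
strategy16 (+ 14) (+ 15) (+ 14) = just upper
strategy16 (+ 15) (+ 0) (+ 0) = just lower
strategy16 (+ 15) (+ 0) (+ 8) = just lower
strategy16 (+ 15) (+ 1) (+ 0) = just lower
strategy16 (+ 15) (+ 1) (+ 1) = just upper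
strategy16 (+ 15) (+ 1) (+ 2) = just upper
strategy16 (+ 15) (+ 1) (+ 3) = just upper
strategy16 (+ 15) (+ 1) (+ 4) = just upper
strategy16 (+ 15) (+ 1) (+ 5) = just upper
strategy16 (+ 15) (+ 1) (+ 6) = just upper
strategy16 (+ 15) (+ 1) (+ 7) = just upper
strategy16 (+ 15) (+ 1) (+ 8) = just upper
strategy16 (+ 15) (+ 1) (+ 9) = just upper
strategy16 (+ 15) (+ 1) (+ 10) = just lower
strategy16 (+ 15) (+ 1) (+ 11) = just upper
strategy16 (+ 15) (+ 1) (+ 12) = just upper
strategy16 (+ 15) (+ 1) (+ 13) = just lower
strategy16 (+ 15) (+ 1) (+ 14) = just upper
strategy16 (+ 15) (+ 1) (+ 15) = just upper
strategy16 (+ 15) (+ 2) (+ 2) = just upper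
strategy16 (+ 15) (+ 2) (+ 14) = just upper
strategy16 (+ 15) (+ 3) (+ 1) = just lower
strategy16 (+ 15) (+ 3) (+ 3) = just upper
strategy16 (+ 15) (+ 3) (+ 5) = just upper
strategy16 (+ 15) (+ 3) (+ 7) = just upper
strategy16 (+ 15) (+ 3) (+ 9) = just lower
strategy16 (+ 15) (+ 3) (+ 11) = just lower
strategy16 (+ 15) (+ 3) (+ 13) = just upper
strategy16 (+ 15) (+ 3) (+ 15) = just lower
strategy16 (+ 15) (+ 4) (+ 4) = just lower
strategy16 (+ 15) (+ 4) (+ 12) = just upper
strategy16 (+ 15) (+ 5) (+ 1) = just lower
strategy16 (+ 15) (+ 5) (+ 3) = just upper
strategy16 (+ 15) (+ 5) (+ 4) = just upper
strategy16 (+ 15) (+ 5) (+ 5) = just lower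
strategy16 (+ 15) (+ 5) (+ 7) = just upper
strategy16 (+ 15) (+ 5) (+ 9) = just lower
strategy16 (+ 15) (+ 5) (+ 11) = just upper
strategy16 (+ 15) (+ 5) (+ 12) = just lower
strategy16 (+ 15) (+ 5) (+ 13) = just upper
strategy16 (+ 15) (+ 5) (+ 15) = just lower
strategy16 (+ 15) (+ 6) (+ 6) = just lower
strategy16 (+ 15) (+ 6) (+ 10) = just lower
strategy16 (+ 15) (+ 7) (+ 1) = just lower
strategy16 (+ 15) (+ 7) (+ 3) = just lower
strategy16 (+ 15) (+ 7) (+ 5) = just upper
strategy16 (+ 15) (+ 7) (+ 7) = just lower
strategy16 (+ 15) (+ 7) (+ 9) = just upper
strategy16 (+ 15) (+ 7) (+ 11) = just upper
strategy16 (+ 15) (+ 7) (+ 13) = just lower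
strategy16 (+ 15) (+ 7) (+ 15) = just lower
strategy16 (+ 15) (+ 8) (+ 0) = just upper
strategy16 (+ 15) (+ 8) (+ 8) = just lower
strategy16 (+ 15) (+ 9) (+ 1) = just lower
strategy16 (+ 15) (+ 9) (+ 2) = just lower
strategy16 (+ 15) (+ 9) (+ 3) = just upper
strategy16 (+ 15) (+ 9) (+ 5) = just upper
strategy16 (+ 15) (+ 9) (+ 6) = just lower
strategy16 (+ 15) (+ 9) (+ 7) = just lower
strategy16 (+ 15) (+ 9) (+ 9) = just upper
strategy16 (+ 15) (+ 9) (+ 10) = just upper
strategy16 (+ 15) (+ 9) (+ 11) = just upper
strategy16 (+ 15) (+ 9) (+ 13) = just lower
strategy16 (+ 15) (+ 9) (+ 14) = just upper
strategy16 (+ 15) (+ 9) (+ 15) = just upper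
strategy16 (+ 15) (+ 10) (+ 6) = just lower
strategy16 (+ 15) (+ 10) (+ 10) = just lower
strategy16 (+ 15) (+ 11) (+ 1) = just lower
strategy16 (+ 15) (+ 11) (+ 3) = just upper
strategy16 (+ 15) (+ 11) (+ 5) = just upper
strategy16 (+ 15) (+ 11) (+ 7) = just lower
strategy16 (+ 15) (+ 11) (+ 9) = just upper
strategy16 (+ 15) (+ 11) (+ 11) = just lower
strategy16 (+ 15) (+ 11) (+ 13) = just upper
strategy16 (+ 15) (+ 11) (+ 15) = just lower
strategy16 (+ 15) (+ 12) (+ 4) = just lower
strategy16 (+ 15) (+ 12) (+ 12) = just lower
strategy16 (+ 15) (+ 13) (+ 0) = just upper
strategy16 (+ 15) (+ 13) (+ 1) = just upper
strategy16 (+ 15) (+ 13) (+ 3) = just lower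
strategy16 (+ 15) (+ 13) (+ 5) = just upper
strategy16 (+ 15) (+ 13) (+ 7) = just upper
strategy16 (+ 15) (+ 13) (+ 8) = just lower
strategy16 (+ 15) (+ 13) (+ 9) = just upper
strategy16 (+ 15) (+ 13) (+ 11) = just lower
strategy16 (+ 15) (+ 13) (+ 13) = just lower
strategy16 (+ 15) (+ 13) (+ 15) = just upper
strategy16 (+ 15) (+ 14) (+ 2) = just upper
strategy16 (+ 15) (+ 14) (+ 14) = just lower
strategy16 (+ 15) (+ 15) (+ 1) = just upper
strategy16 (+ 15) (+ 15) (+ 3) = just lower
strategy16 (+ 15) (+ 15) (+ 5) = just upper
strategy16 (+ 15) (+ 15) (+ 7) = just lower
strategy16 (+ 15) (+ 15) (+ 9) = just upper
strategy16 (+ 15) (+ 15) (+ 11) = just upper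
strategy16 (+ 15) (+ 15) (+ 13) = just lower
strategy16 (+ 15) (+ 15) (+ 15) = just lower
strategy16 _ _ _ = nothing

representatives16 : List Triple
representatives16 = (+ 0 , + 0 , + 0) ∷ (+ 0 , + 0 , + 8) ∷ (+ 0 , + 1 , + 0) ∷ (+ 0 , + 2 , + 0) ∷ (+ 0 , + 2 , + 8) ∷ (+ 0 , + 3 , + 0) ∷ (+ 0 , + 4 , + 0) ∷ (+ 0 , + 4 , + 8) ∷ (+ 0 , + 5 , + 0) ∷ (+ 0 , + 6 , + 0) ∷ (+ 0 , + 6 , + 8) ∷ (+ 0 , + 7 , + 0) ∷ (+ 0 , + 8 , + 0) ∷ (+ 0 , + 10 , + 0) ∷ (+ 0 , + 12 , + 0) ∷ (+ 0 , + 14 , + 0) ∷ (+ 1 , + 1 , + 1) ∷ (+ 1 , + 1 , + 3) ∷ (+ 1 , + 1 , + 5) ∷ (+ 1 , + 1 , + 7) ∷ (+ 1 , + 2 , + 2) ∷ (+ 1 , + 4 , + 4) ∷ (+ 1 , + 6 , + 6) ∷ (+ 2 , + 1 , + 2) ∷ (+ 2 , + 2 , + 4) ∷ (+ 2 , + 4 , + 8) ∷ (+ 3 , + 2 , + 6) ∷ (+ 3 , + 5 , + 6) ∷ (+ 4 , + 1 , + 4) ∷ (+ 4 , + 2 , + 8) ∷ (+ 4 , + 4 , + 8) ∷ (+ 4 , + 6 , + 8) ∷ (+ 4 , + 8 , + 8) ∷ (+ 5 , + 3 , + 6) ∷ (+ 8 , + 4 , + 8) ∷ (+ 8 , + 8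 , + 8) ∷ []

κ-residues16 : List ℕ
κ-residues16 = 0 ∷ 1 ∷ 4 ∷ 5 ∷ 9 ∷ 12 ∷ 13 ∷ []

module Modulo16 = ResidueCertificate 2 4 strategy16 representatives16 12 κ-residues16

-- Each tt is a certificate check, decided by evaluation.
commutatorTrace-mod9 : ∀ (t : ℤp 3) →
  (t ≡ᵖ + 1 [mod^ 2 ] ⊎ t ≡ᵖ + 4 [mod^ 2 ] ⊎ t ≡ᵖ + 5 [mod^ 2 ] ⊎ t ≡ᵖ + 8 [mod^ 2 ])
  → ¬ InImage t
commutatorTrace-mod9 t =
  [ excluded (+ 1) tt , [ excluded (+ 4) tt , [ excluded (+ 5) tt , excluded (+ 8) tt ]′ ]′ ]′
  where
  excluded : ∀ t₀ → T (Modulo9.excludes (t₀ - + 2)) → t ≡ᵖ t₀ [mod^ 2 ] → ¬ InImage t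
  excluded t₀ ok = Modulo9.noPreimage tt tt t₀ ok t

commutatorTrace-mod16 : ∀ (t : ℤp 2) →
  (t ≡ᵖ + 0 [mod^ 4 ] ⊎ t ≡ᵖ + 1 [mod^ 4 ] ⊎ t ≡ᵖ + 4 [mod^ 4 ]
   ⊎ t ≡ᵖ + 5 [mod^ 4 ] ⊎ t ≡ᵖ + 8 [mod^ 4 ] ⊎ t ≡ᵖ + 9 [mod^ 4 ]
   ⊎ t ≡ᵖ + 10 [mod^ 4 ] ⊎ t ≡ᵖ + 12 [mod^ 4 ] ⊎ t ≡ᵖ + 13 [mod^ 4 ])
  → ¬ InImage t
commutatorTrace-mod16 t =
  [ excluded (+ 0) tt , [ excluded (+ 1) tt , [ excluded (+ 4) tt , [ excluded (+ 5) tt ,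
  [ excluded (+ 8) tt , [ excluded (+ 9) tt , [ excluded (+ 10) tt ,
  [ excluded (+ 12) tt , excluded (+ 13) tt ]′ ]′ ]′ ]′ ]′ ]′ ]′ ]′
  where
  excluded : ∀ t₀ → T (Modulo16.excludes (t₀ - + 2)) → t ≡ᵖ t₀ [mod^ 4 ] → ¬ InImage t
  excluded t₀ ok = Modulo16.noPreimage tt tt t₀ ok t

proposition5p12 :
  (∀ (p : ℕ) → Prime p → 3 < p → (t : ℤp p) → InImage t)
  × (∀ (t : ℤp 3) →
       (t ≡ᵖ + 1 [mod^ 2 ] ⊎ t ≡ᵖ + 4 [mod^ 2 ] ⊎ t ≡ᵖ + 5 [mod^ 2 ] ⊎ t ≡ᵖ + 8 [mod^ 2 ])
       → ¬ InImage t)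
  × (∀ (t : ℤp 2) →
       (t ≡ᵖ + 0 [mod^ 4 ] ⊎ t ≡ᵖ + 1 [mod^ 4 ] ⊎ t ≡ᵖ + 4 [mod^ 4 ]
        ⊎ t ≡ᵖ + 5 [mod^ 4 ] ⊎ t ≡ᵖ + 8 [mod^ 4 ] ⊎ t ≡ᵖ + 9 [mod^ 4 ]
        ⊎ t ≡ᵖ + 10 [mod^ 4 ] ⊎ t ≡ᵖ + 12 [mod^ 4 ] ⊎ t ≡ᵖ + 13 [mod^ 4 ])
       → ¬ InImage t)
proposition5p12 = commutatorTrace-surjective , commutatorTrace-mod9 , commutatorTrace-mod16
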